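{- Let $p$ be a prime, $\ell\ge1$, and let $f\in P_{p^\ell}$ be idempotent with idempotency index $\eta$ and generating vector $(e_0,\dots,e_{\eta-1})$. For every $s\ge1$, $$\Sigma^sf=\Delta^{\overline{ -s}}f-\sum_{j=0}^{s-1}\Sigma^j[e_{\overline{j-s}}],$$ and this is the decomposition of $\Sigma^sf$ into its idempotent part $\Delta^{\overline{ -s}}f$ and its nilpotent part $-\sum_{j=0}^{s-1}\Sigma^j[e_{\overline{j-s}}]$. Moreover, if $e_\gamma$ is the leading component of the generating vector, then $\tau(\Sigma^sf)=\mathrm{lcm}\big(\tau(f),\tau(\Sigma^{s-\eta+\gamma}[e_\gamma])\big)$ for all sufficiently large $s$.
   Context: $P_{p^\ell}$ is the module of periodic sequences $\mathbb{N}\to\mathbb{Z}_{p^\ell}$, and $\tau$ is the minimal period. $\Delta f(n)=f(n+1)-f(n)$. Idempotent means $\Delta^\eta f=f$ for some $\eta\ge1$ (minimal such $\eta$: idempotency index); nilpotent means $\Delta^\eta g=0$ for some $\eta\ge1$. The generating vector has entries $e_i=\Delta^if(0)$, $0\le i<\eta$. Its leading component is the last entry with minimal $p$-adic valuation, where the valuation of $0$ is $\infty$. For $z\in\mathbb{Z}$, $\overline z\in\{0,\dots,\eta-1\}$ is the remainder of $z$ modulo $\eta$. $[c]$ is the constant sequence. $\Sigma$ is the sum operator $\Sigma f(0)=0$, $\Sigma f(n)=f(n-1)+\Sigma f(n-1)$, and $\Sigma^0=\mathrm{id}$. -}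

module Defs where

open import Data.Nat as ℕ using (ℕ; zero; suc; _≤_; _<_; _^_)
open import Data.Integer as ℤ using (ℤ; +_; _-_; _+_; -_; _%ℕ_)
open import Data.Integer.Divisibility as ℤD using ()
open import Data.Product using (Σ; ∃; _×_; _,_)
open import Relation.Nullary using (¬_)

-- Sequences ℕ → ℤ_m are represented by ℕ → ℤ, with all equalities
-- read modulo m (ℤ_m = ℤ / mℤ).
Seq : Set
Seq = ℕ → ℤ

_≡_[mod_] : ℤ → ℤ → ℕ → Set
a ≡ b [mod m ] = (+ m) ℤD.∣ (a - b)

_≈_[mod_] : Seq → Seq → ℕ → Set
f ≈ g [mod m ] = ∀ n → f n ≡ g n [mod m ]

Δ : Seq → Seq
Δ f n = f (suc n) - f n

Δ^ : ℕ → Seq → Seq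
Δ^ zero    f = f
Δ^ (suc k) f = Δ (Δ^ k f)

Σop : Seq → Seq
Σop f zero    = + 0
Σop f (suc n) = f n + Σop f n

Σ^ : ℕ → Seq → Seq
Σ^ zero    f = f
Σ^ (suc k) f = Σop (Σ^ k f)

[_] : ℤ → Seq
[ c ] _ = c

𝟘 : Seq
𝟘 _ = + 0

_⊕_ : Seq → Seq → Seq
(f ⊕ g) n = f n + g n

⊖_ : Seq → Seq
(⊖ f) n = - (f n)

sumSeq : ℕ → (ℕ → Seq) → Seq
sumSeq zero    F = 𝟘
sumSeq (suc s) F = sumSeq s F ⊕ F s

IsPeriod : ℕ → Seq → ℕ → Set
IsPeriod m f T = 1 ≤ T × (∀ n → f (n ℕ.+ T) ≡ f n [mod m ])

IsPeriodic : ℕ → Seq → Set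
IsPeriodic m f = ∃ λ T → IsPeriod m f T

IsMinPeriod : ℕ → Seq → ℕ → Set
IsMinPeriod m f τ = IsPeriod m f τ × (∀ T → IsPeriod m f T → τ ≤ T)

IsIdempotent : ℕ → Seq → Set
IsIdempotent m f = ∃ λ η → 1 ≤ η × (Δ^ η f ≈ f [mod m ])

IsNilpotent : ℕ → Seq → Set
IsNilpotent m g = ∃ λ η → 1 ≤ η × (Δ^ η g ≈ 𝟘 [mod m ])

IsIdempotencyIndex : ℕ → Seq → ℕ → Set
IsIdempotencyIndex m f η =
  1 ≤ η × (Δ^ η f ≈ f [mod m ]) ×
  (∀ η' → 1 ≤ η' → Δ^ η' f ≈ f [mod m ] → η ≤ η')

gen : Seq → ℕ → ℤ
gen f i = Δ^ i f 0

-- remainder of z modulo η, in {0,…,η-1} (η = 0 never occurs in use)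
rem : ℤ → ℕ → ℕ
rem z zero    = 0
rem z (suc k) = z %ℕ suc k

-- p-adic valuation of an element x of ℤ_{p^ℓ}:
-- HasVal p ℓ x k  means  v_p(x) = k, where k = ℓ encodes ∞ (x ≡ 0 mod p^ℓ)
-- and otherwise k < ℓ is the exponent of p in x.
HasVal : ℕ → ℕ → ℤ → ℕ → Set
HasVal p ℓ x k =
  k ≤ ℓ × ((+ (p ^ k)) ℤD.∣ x) × (k < ℓ → ¬ ((+ (p ^ suc k)) ℤD.∣ x))

-- e_γ is the leading component of the generating vector (e_0,…,e_{η-1})
-- of f in ℤ_{p^ℓ}: the last entry of minimal valuation.
IsLeading : ℕ → ℕ → Seq → ℕ → ℕ → Set
IsLeading p ℓ f η γ =
  γ < η × ∃ λ k → HasVal p ℓ (gen f γ) k ×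
    (∀ i j → i < η → HasVal p ℓ (gen f i) j → k ≤ j × (γ < i → k < j))

-- Discrete Taylor: Σ^s Δ^s g = g − Σ_{j<s} Σ^j [Δ^j g(0)].  Taking g = Δ^r f with
-- r ≡ −s (mod η), so that Δ^s g = Δ^(s+r) f = f, splits Σ^s f into Δ^r f, which is
-- idempotent with the periods of f, and a sum of iterated sums of constants, killed by Δ^s.
--
-- A period of Σ^s f is a period of f = Δ^s Σ^s f, hence of Δ^r f and of the nilpotent part,
-- so the minimal period of Σ^s f is the lcm of those of f and of the nilpotent part.  The
-- nilpotent part and Σ^{j₀} [e_γ], j₀ = s + γ − η, have Newton coefficients Δ^j h(0) of
-- valuation ≥ v below s, vanishing from s on, exactly v at j₀ and > v between j₀ and s.
-- Expanding h(n + T) − h(n) = Σ_k C(T, k+1) Δ^(k+1) h(n) and using the p-adic valuation of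
-- C(p^a, k), such an h has period p^(t+1) but not p^t, where t depends only on v, ℓ and
-- ⌊log_p j₀⌋ once s ≤ j₀ + p^⌊log_p j₀⌋, which holds for s ≥ η(p + 1).  So both have the
-- same periods.

module Submission where

open import Defs
open import Data.Nat as ℕ using (ℕ; zero; suc; z≤n; s≤s; _≤_; _<_; _∸_; _^_)
import Data.Nat.Properties as ℕ
import Data.Nat.DivMod as ℕ
open import Data.Nat.Divisibility as ℕ using (_∣_; divides; _∣?_; m∣m*n; n∣m*n)
open import Data.Nat.GCD using (gcd; gcd-GCD; gcd[m,n]∣m; gcd[m,n]∣n; gcd[m,n]≢0; module Bézout)
open import Data.Nat.LCM using (lcm; m∣lcm[m,n]; n∣lcm[m,n]; lcm-least)
open import Data.Nat.Coprimality using (Coprime; coprime-divisor)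
open import Data.Nat.Primality using (Prime; euclidsLemma; prime⇒irreducible; prime⇒nonTrivial; prime⇒nonZero)
open import Data.Nat.Combinatorics using (_C_; nC1≡n; nCk+nC[k+1]≡[n+1]C[k+1])
import Data.Nat.Tactic.RingSolver as ℕ-Solver
open import Data.Integer as ℤ using (ℤ; +_; -_; _-_; _+_; _*_; +0)
import Data.Integer.Properties as ℤ
open import Data.Integer.DivMod as ℤ using (_/ℕ_)
open import Data.Integer.Divisibility.Signed as ∣ₛ using () renaming (_∣_ to _∣ₛ_)
open import Data.Integer.Tactic.RingSolver using (solve-∀)
open import Data.Empty using (⊥-elim)
open import Data.Product using (∃; _×_; _,_; proj₁; proj₂)
open import Data.Sum using (_⊎_; inj₁; inj₂)
open import Function using (_∘_; _⇔_; mk⇔; Equivalence)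
import Function.Properties.Equivalence as ⇔
open import Level using (0ℓ)
open import Relation.Nullary using (¬_; yes; no)
open import Relation.Binary.Bundles using (Setoid)
open import Relation.Binary.Definitions using (tri<; tri≈; tri>)
open import Relation.Binary.PropositionalEquality hiding ([_])
import Relation.Binary.Reasoning.Setoid as SetoidReasoning

-- Unlike the congruence of Defs, which unfolds to divisibility of ∣ a - b ∣,
-- this record keeps a and b visible to unification.
infix 4 _≡_⟨mod_⟩
record _≡_⟨mod_⟩ (a b : ℤ) (m : ℕ) : Set where
  constructor mod
  field m∣a-b : (+ m) ∣ₛ (a - b)
open _≡_⟨mod_⟩ public

≡-mod-by : ∀ {m a b c} → a - b ≡ c → (+ m) ∣ₛ c → a ≡ b ⟨mod m ⟩
≡-mod-by refl m∣c = mod m∣c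

∣ₛ-zero : ∀ m → (+ m) ∣ₛ +0
∣ₛ-zero m = ∣ₛ.divides +0 refl

≡⇒≡-mod : ∀ {m a b} → a ≡ b → a ≡ b ⟨mod m ⟩
≡⇒≡-mod {m} {a} refl = ≡-mod-by (ℤ.+-inverseʳ a) (∣ₛ-zero m)

≡-mod-refl : ∀ {m a} → a ≡ a ⟨mod m ⟩
≡-mod-refl = ≡⇒≡-mod refl

≡-mod-sym : ∀ {m a b} → a ≡ b ⟨mod m ⟩ → b ≡ a ⟨mod m ⟩
≡-mod-sym {a = a} {b} (mod m∣a-b) = ≡-mod-by (lemma a b) (∣ₛ.∣m⇒∣-m m∣a-b)
  where lemma : ∀ a b → b - a ≡ - (a - b)
        lemma = solve-∀

≡-mod-trans : ∀ {m a b c} → a ≡ b ⟨mod m ⟩ → b ≡ c ⟨mod m ⟩ → a ≡ c ⟨mod m ⟩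
≡-mod-trans {a = a} {b} {c} (mod m∣a-b) (mod m∣b-c) = ≡-mod-by (lemma a b c) (∣ₛ.∣m∣n⇒∣m+n m∣a-b m∣b-c)
  where lemma : ∀ a b c → a - c ≡ (a - b) + (b - c)
        lemma = solve-∀

+-cong-mod : ∀ {m a b c d} → a ≡ b ⟨mod m ⟩ → c ≡ d ⟨mod m ⟩ → a + c ≡ b + d ⟨mod m ⟩
+-cong-mod {a = a} {b} {c} {d} (mod m∣a-b) (mod m∣c-d) = ≡-mod-by (lemma a b c d) (∣ₛ.∣m∣n⇒∣m+n m∣a-b m∣c-d)
  where lemma : ∀ a b c d → (a + c) - (b + d) ≡ (a - b) + (c - d)
        lemma = solve-∀

neg-cong-mod : ∀ {m a b} → a ≡ b ⟨mod m ⟩ → - a ≡ - b ⟨mod m ⟩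
neg-cong-mod {a = a} {b} (mod m∣a-b) = ≡-mod-by (lemma a b) (∣ₛ.∣m⇒∣-m m∣a-b)
  where lemma : ∀ a b → - a - - b ≡ - (a - b)
        lemma = solve-∀

-‿cong-mod : ∀ {m a b c d} → a ≡ b ⟨mod m ⟩ → c ≡ d ⟨mod m ⟩ → a - c ≡ b - d ⟨mod m ⟩
-‿cong-mod a≡b c≡d = +-cong-mod a≡b (neg-cong-mod c≡d)

[mod]⇒⟨mod⟩ : ∀ {m a b} → a ≡ b [mod m ] → a ≡ b ⟨mod m ⟩
[mod]⇒⟨mod⟩ m∣a-b = mod (∣ₛ.∣ᵤ⇒∣ m∣a-b)

⟨mod⟩⇒[mod] : ∀ {m a b} → a ≡ b ⟨mod m ⟩ → a ≡ b [mod m ]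
⟨mod⟩⇒[mod] (mod m∣a-b) = ∣ₛ.∣⇒∣ᵤ m∣a-b

∣⇒≡0-mod : ∀ {m a} → (+ m) ∣ₛ a → a ≡ +0 ⟨mod m ⟩
∣⇒≡0-mod {a = a} m∣a = ≡-mod-by (ℤ.+-identityʳ a) m∣a

ℤ-mod : ℕ → Setoid 0ℓ 0ℓ
ℤ-mod m = record
  { Carrier       = ℤ
  ; _≈_           = _≡_⟨mod m ⟩
  ; isEquivalence = record { refl = ≡-mod-refl ; sym = ≡-mod-sym ; trans = ≡-mod-trans }
  }

module ≡-mod-Reasoning (m : ℕ) = SetoidReasoning (ℤ-mod m)

infix 4 _≈_⟨mod_⟩
_≈_⟨mod_⟩ : Seq → Seq → ℕ → Set
f ≈ g ⟨mod m ⟩ = ∀ n → f n ≡ g n ⟨mod m ⟩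

≗⇒≈-mod : ∀ {m f g} → f ≗ g → f ≈ g ⟨mod m ⟩
≗⇒≈-mod f≗g n = ≡⇒≡-mod (f≗g n)

≈-mod-sym : ∀ {m f g} → f ≈ g ⟨mod m ⟩ → g ≈ f ⟨mod m ⟩
≈-mod-sym f≈g n = ≡-mod-sym (f≈g n)

≈-mod-trans : ∀ {m f g h} → f ≈ g ⟨mod m ⟩ → g ≈ h ⟨mod m ⟩ → f ≈ h ⟨mod m ⟩
≈-mod-trans f≈g g≈h n = ≡-mod-trans (f≈g n) (g≈h n)

≈[mod]⇒⟨mod⟩ : ∀ {m f g} → f ≈ g [mod m ] → f ≈ g ⟨mod m ⟩
≈[mod]⇒⟨mod⟩ f≈g n = [mod]⇒⟨mod⟩ (f≈g n)

≈⟨mod⟩⇒[mod] : ∀ {m f g} → f ≈ g ⟨mod m ⟩ → f ≈ g [mod m ]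
≈⟨mod⟩⇒[mod] f≈g n = ⟨mod⟩⇒[mod] (f≈g n)

Seq-mod : ℕ → Setoid 0ℓ 0ℓ
Seq-mod m = record
  { Carrier       = Seq
  ; _≈_           = _≈_⟨mod m ⟩
  ; isEquivalence = record { refl = λ _ → ≡-mod-refl ; sym = ≈-mod-sym ; trans = ≈-mod-trans }
  }

Δ-cong : ∀ {f g} → f ≗ g → Δ f ≗ Δ g
Δ-cong f≗g n = cong₂ _-_ (f≗g (suc n)) (f≗g n)

Δ^-cong : ∀ k {f g} → f ≗ g → Δ^ k f ≗ Δ^ k g
Δ^-cong zero    f≗g = f≗g
Δ^-cong (suc k) f≗g = Δ-cong (Δ^-cong k f≗g)

Σ-cong : ∀ {f g} → f ≗ g → Σop f ≗ Σop g
Σ-cong f≗g zero    = refl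
Σ-cong f≗g (suc n) = cong₂ _+_ (f≗g n) (Σ-cong f≗g n)

Σ^-cong : ∀ k {f g} → f ≗ g → Σ^ k f ≗ Σ^ k g
Σ^-cong zero    f≗g = f≗g
Σ^-cong (suc k) f≗g = Σ-cong (Σ^-cong k f≗g)

sumSeq-cong : ∀ s {F G} → (∀ i → i < s → F i ≗ G i) → sumSeq s F ≗ sumSeq s G
sumSeq-cong zero    F≗G n = refl
sumSeq-cong (suc s) F≗G n =
  cong₂ _+_ (sumSeq-cong s (λ i i<s → F≗G i (ℕ.m<n⇒m<1+n i<s)) n) (F≗G s ℕ.≤-refl n)

Δ-cong-mod : ∀ {m f g} → f ≈ g ⟨mod m ⟩ → Δ f ≈ Δ g ⟨mod m ⟩
Δ-cong-mod f≈g n = -‿cong-mod (f≈g (suc n)) (f≈g n)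

Δ^-cong-mod : ∀ {m} k {f g} → f ≈ g ⟨mod m ⟩ → Δ^ k f ≈ Δ^ k g ⟨mod m ⟩
Δ^-cong-mod zero    f≈g = f≈g
Δ^-cong-mod (suc k) f≈g = Δ-cong-mod (Δ^-cong-mod k f≈g)

Σ-cong-mod : ∀ {m f g} → f ≈ g ⟨mod m ⟩ → Σop f ≈ Σop g ⟨mod m ⟩
Σ-cong-mod f≈g zero    = ≡-mod-refl
Σ-cong-mod f≈g (suc n) = +-cong-mod (f≈g n) (Σ-cong-mod f≈g n)

Σ^-cong-mod : ∀ {m} k {f g} → f ≈ g ⟨mod m ⟩ → Σ^ k f ≈ Σ^ k g ⟨mod m ⟩
Σ^-cong-mod zero    f≈g = f≈g
Σ^-cong-mod (suc k) f≈g = Σ-cong-mod (Σ^-cong-mod k f≈g)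

sumSeq-cong-mod : ∀ {m} s {F G} → (∀ i → F i ≈ G i ⟨mod m ⟩) → sumSeq s F ≈ sumSeq s G ⟨mod m ⟩
sumSeq-cong-mod zero    F≈G n = ≡-mod-refl
sumSeq-cong-mod (suc s) F≈G n = +-cong-mod (sumSeq-cong-mod s F≈G n) (F≈G s n)

Δ^-+ : ∀ a b f → Δ^ (a ℕ.+ b) f ≗ Δ^ a (Δ^ b f)
Δ^-+ zero    b f n = refl
Δ^-+ (suc a) b f   = Δ-cong (Δ^-+ a b f)

Δ^-suc : ∀ k f → Δ^ (suc k) f ≗ Δ^ k (Δ f)
Δ^-suc k f n = trans (cong (λ i → Δ^ i f n) (ℕ.+-comm 1 k)) (Δ^-+ k 1 f n)

Δ-Σ : ∀ f → Δ (Σop f) ≗ f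
Δ-Σ f n = lemma (f n) (Σop f n)
  where lemma : ∀ a b → (a + b) - b ≡ a
        lemma = solve-∀

Σ-Δ : ∀ g → Σop (Δ g) ≗ (λ n → g n - g 0)
Σ-Δ g zero    = sym (ℤ.+-inverseʳ (g 0))
Σ-Δ g (suc n) = trans (cong (λ x → Δ g n + x) (Σ-Δ g n)) (lemma (g (suc n)) (g n) (g 0))
  where lemma : ∀ a b c → (a - b) + (b - c) ≡ a - c
        lemma = solve-∀

Δ^-Σ^ : ∀ j i g → Δ^ j (Σ^ (j ℕ.+ i) g) ≗ Σ^ i g
Δ^-Σ^ zero    i g n = refl
Δ^-Σ^ (suc j) i g n = begin
  Δ^ (suc j) (Σ^ (suc j ℕ.+ i) g) n   ≡⟨ Δ^-suc j _ n ⟩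
  Δ^ j (Δ (Σop (Σ^ (j ℕ.+ i) g))) n   ≡⟨ Δ^-cong j (Δ-Σ _) n ⟩
  Δ^ j (Σ^ (j ℕ.+ i) g) n             ≡⟨ Δ^-Σ^ j i g n ⟩
  Σ^ i g n                            ∎
  where open ≡-Reasoning

Δ^-Σ^-same : ∀ j g → Δ^ j (Σ^ j g) ≗ g
Δ^-Σ^-same j g n = trans (cong (λ i → Δ^ j (Σ^ i g) n) (sym (ℕ.+-identityʳ j))) (Δ^-Σ^ j 0 g n)

Δ^-𝟘 : ∀ k → Δ^ k 𝟘 ≗ 𝟘
Δ^-𝟘 zero    n = refl
Δ^-𝟘 (suc k) n = Δ-cong (Δ^-𝟘 k) n

Δ^-const : ∀ k c → Δ^ (suc k) [ c ] ≗ 𝟘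
Δ^-const k c n = trans (Δ^-suc k [ c ] n) (trans (Δ^-cong k (λ _ → ℤ.+-inverseʳ c) n) (Δ^-𝟘 k n))

Δ^-⊕ : ∀ k f g → Δ^ k (f ⊕ g) ≗ Δ^ k f ⊕ Δ^ k g
Δ^-⊕ zero    f g n = refl
Δ^-⊕ (suc k) f g n = trans (Δ-cong (Δ^-⊕ k f g) n) (lemma (Δ^ k f (suc n)) (Δ^ k g (suc n)) (Δ^ k f n) (Δ^ k g n))
  where lemma : ∀ a b c d → (a + b) - (c + d) ≡ (a - c) + (b - d)
        lemma = solve-∀

Δ^-⊖ : ∀ k f → Δ^ k (⊖ f) ≗ ⊖ Δ^ k f
Δ^-⊖ zero    f n = refl
Δ^-⊖ (suc k) f n = trans (Δ-cong (Δ^-⊖ k f) n) (lemma (Δ^ k f (suc n)) (Δ^ k f n))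
  where lemma : ∀ a b → - a - - b ≡ - (a - b)
        lemma = solve-∀

Δ^-sumSeq : ∀ k s F → Δ^ k (sumSeq s F) ≗ sumSeq s (λ i → Δ^ k (F i))
Δ^-sumSeq k zero    F n = Δ^-𝟘 k n
Δ^-sumSeq k (suc s) F n = trans (Δ^-⊕ k (sumSeq s F) (F s) n) (cong (_+ Δ^ k (F s) n) (Δ^-sumSeq k s F n))

Σ-⊕ : ∀ f g → Σop (f ⊕ g) ≗ Σop f ⊕ Σop g
Σ-⊕ f g zero    = refl
Σ-⊕ f g (suc n) = trans (cong (λ x → (f n + g n) + x) (Σ-⊕ f g n)) (lemma (f n) (g n) (Σop f n) (Σop g n))
  where lemma : ∀ a b c d → (a + b) + (c + d) ≡ (a + c) + (b + d)
        lemma = solve-∀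

Σ-⊖ : ∀ f → Σop (⊖ f) ≗ ⊖ Σop f
Σ-⊖ f zero    = refl
Σ-⊖ f (suc n) = trans (cong (λ x → - f n + x) (Σ-⊖ f n)) (sym (ℤ.neg-distrib-+ (f n) (Σop f n)))

Σ-𝟘 : Σop 𝟘 ≗ 𝟘
Σ-𝟘 zero    = refl
Σ-𝟘 (suc n) = trans (ℤ.+-identityˡ (Σop 𝟘 n)) (Σ-𝟘 n)

Σ-sumSeq : ∀ s F → Σop (sumSeq s F) ≗ sumSeq s (λ i → Σop (F i))
Σ-sumSeq zero    F n = Σ-𝟘 n
Σ-sumSeq (suc s) F n = trans (Σ-⊕ (sumSeq s F) (F s) n) (cong (_+ Σop (F s) n) (Σ-sumSeq s F n))

sumSeq-suc : ∀ s F → sumSeq (suc s) F ≗ F 0 ⊕ sumSeq s (λ i → F (suc i))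
sumSeq-suc zero    F n = ℤ.+-comm +0 (F 0 n)
sumSeq-suc (suc s) F n = trans (cong (_+ F (suc s) n) (sumSeq-suc s F n)) (ℤ.+-assoc (F 0 n) _ _)

Σ^-Δ^ : ∀ s g → Σ^ s (Δ^ s g) ≗ g ⊕ (⊖ sumSeq s (λ j → Σ^ j [ gen g j ]))
Σ^-Δ^ zero    g n = sym (ℤ.+-identityʳ (g n))
Σ^-Δ^ (suc s) g n = begin
  Σop (Σ^ s (Δ^ (suc s) g)) n                                 ≡⟨ Σ-cong (Σ^-cong s (Δ^-suc s g)) n ⟩
  Σop (Σ^ s (Δ^ s (Δ g))) n                                   ≡⟨ Σ-cong (Σ^-Δ^ s (Δ g)) n ⟩
  Σop (Δ g ⊕ (⊖ sumSeq s G)) n                                 ≡⟨ Σ-⊕ (Δ g) _ n ⟩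
  Σop (Δ g) n + Σop (⊖ sumSeq s G) n                          ≡⟨ cong₂ _+_ (Σ-Δ g n) (Σ-⊖ _ n) ⟩
  (g n - g 0) - Σop (sumSeq s G) n                            ≡⟨ cong (λ x → (g n - g 0) - x) (Σ-sumSeq s G n) ⟩
  (g n - g 0) - sumSeq s (λ j → Σop (G j)) n                  ≡⟨ cong (λ x → (g n - g 0) - x) (sumSeq-cong s shift n) ⟩
  (g n - g 0) - sumSeq s (λ j → F (suc j)) n                  ≡⟨ lemma (g n) (g 0) _ ⟩
  g n - (g 0 + sumSeq s (λ j → F (suc j)) n)                  ≡⟨ cong (λ x → g n - x) (sym (sumSeq-suc s F n)) ⟩
  g n - sumSeq (suc s) F n                                    ∎
  where
  open ≡-Reasoning
  G F : ℕ → Seq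
  G j = Σ^ j [ gen (Δ g) j ]
  F j = Σ^ j [ gen g j ]
  shift : ∀ j → j < s → Σop (G j) ≗ F (suc j)
  shift j _ = Σ-cong (Σ^-cong j (λ _ → sym (Δ^-suc j g 0)))
  lemma : ∀ a b c → (a - b) - c ≡ a - (b + c)
  lemma = solve-∀

-- Newton coefficients

suc-∸-+ : ∀ {i j} → i < j → suc (j ∸ suc i ℕ.+ i) ≡ j
suc-∸-+ {i} {j} i<j = trans (sym (ℕ.+-suc (j ∸ suc i) i)) (ℕ.m∸n+n≡m i<j)

Δ^-Σ^-const-above : ∀ {i j} c → i < j → Δ^ j (Σ^ i [ c ]) ≗ 𝟘
Δ^-Σ^-const-above {i} {j} c i<j n = begin
  Δ^ j (Σ^ i [ c ]) n               ≡⟨ cong (λ t → Δ^ t (Σ^ i [ c ]) n) (sym (suc-∸-+ i<j)) ⟩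
  Δ^ (suc k ℕ.+ i) (Σ^ i [ c ]) n   ≡⟨ Δ^-+ (suc k) i _ n ⟩
  Δ^ (suc k) (Δ^ i (Σ^ i [ c ])) n  ≡⟨ Δ^-cong (suc k) (Δ^-Σ^-same i [ c ]) n ⟩
  Δ^ (suc k) [ c ] n                ≡⟨ Δ^-const k c n ⟩
  +0                                ∎
  where
  open ≡-Reasoning
  k : ℕ
  k = j ∸ suc i

gen-Σ^-below : ∀ {i j} g → j < i → gen (Σ^ i g) j ≡ +0
gen-Σ^-below {i} {j} g j<i = begin
  Δ^ j (Σ^ i g) 0                ≡⟨ cong (λ t → Δ^ j (Σ^ t g) 0) (sym (ℕ.m+[n∸m]≡n (ℕ.<⇒≤ j<i))) ⟩
  Δ^ j (Σ^ (j ℕ.+ (i ∸ j)) g) 0  ≡⟨ Δ^-Σ^ j (i ∸ j) g 0 ⟩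
  Σ^ (i ∸ j) g 0                 ≡⟨ Σ^-at-0 (ℕ.m<n⇒0<n∸m j<i) ⟩
  +0                             ∎
  where
  open ≡-Reasoning
  Σ^-at-0 : ∀ {k} → 0 < k → Σ^ k g 0 ≡ +0
  Σ^-at-0 {suc k} _ = refl

gen-⊕ : ∀ f g j → gen (f ⊕ g) j ≡ gen f j + gen g j
gen-⊕ f g j = Δ^-⊕ j f g 0

gen-⊖ : ∀ f j → gen (⊖ f) j ≡ - gen f j
gen-⊖ f j = Δ^-⊖ j f 0

sumSeq-vanish : ∀ s {F} → (∀ i → i < s → F i ≗ 𝟘) → sumSeq s F ≗ 𝟘
sumSeq-vanish zero    F≗𝟘 n = refl
sumSeq-vanish (suc s) F≗𝟘 n =
  cong₂ _+_ (sumSeq-vanish s (λ i i<s → F≗𝟘 i (ℕ.m<n⇒m<1+n i<s)) n) (F≗𝟘 s ℕ.≤-refl n)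

module _ (c : ℕ → ℤ) where

  Σ^-poly : ℕ → Seq
  Σ^-poly s = sumSeq s (λ i → Σ^ i [ c i ])

  Δ^-Σ^-poly : ∀ s → Δ^ s (Σ^-poly s) ≗ 𝟘
  Δ^-Σ^-poly s n = trans (Δ^-sumSeq s s _ n) (sumSeq-vanish s (λ i i<s → Δ^-Σ^-const-above (c i) i<s) n)

  gen-Σ^-poly-≥ : ∀ {s j} → s ≤ j → gen (Σ^-poly s) j ≡ +0
  gen-Σ^-poly-≥ {s} {j} s≤j = trans (Δ^-sumSeq j s _ 0)
    (sumSeq-vanish s (λ i i<s → Δ^-Σ^-const-above (c i) (ℕ.<-≤-trans i<s s≤j)) 0)

  gen-Σ^-poly-< : ∀ {s j} → j < s → gen (Σ^-poly s) j ≡ c j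
  gen-Σ^-poly-< {suc s} {j} (s≤s j≤s) with ℕ.m≤n⇒m<n∨m≡n j≤s
  ... | inj₁ j<s  = begin
    gen (Σ^-poly (suc s)) j                   ≡⟨ gen-⊕ (Σ^-poly s) _ j ⟩
    gen (Σ^-poly s) j + gen (Σ^ s [ c s ]) j  ≡⟨ cong₂ _+_ (gen-Σ^-poly-< j<s) (gen-Σ^-below _ j<s) ⟩
    c j + +0                                  ≡⟨ ℤ.+-identityʳ (c j) ⟩
    c j                                       ∎
    where open ≡-Reasoning
  ... | inj₂ refl = begin
    gen (Σ^-poly (suc j)) j                   ≡⟨ gen-⊕ (Σ^-poly j) _ j ⟩
    gen (Σ^-poly j) j + gen (Σ^ j [ c j ]) j  ≡⟨ cong₂ _+_ (gen-Σ^-poly-≥ {j} ℕ.≤-refl) (Δ^-Σ^-same j [ c j ] 0) ⟩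
    +0 + c j                                  ≡⟨ ℤ.+-identityˡ (c j) ⟩
    c j                                       ∎
    where open ≡-Reasoning

∣∧<⇒≡0 : ∀ {η n} → η ℕ.∣ n → n < η → n ≡ 0
∣∧<⇒≡0 {n = zero}  _   _   = refl
∣∧<⇒≡0 {n = suc n} η∣n n<η with () ← ℕ.>⇒∤ n<η η∣n

residue-unique-≤ : ∀ {η a b} → a ≤ b → b < η → + a ≡ + b ⟨mod η ⟩ → a ≡ b
residue-unique-≤ {η} {a} {b} a≤b b<η (mod η∣a-b) =
  ℕ.≤-antisym a≤b (ℕ.m∸n≡0⇒m≤n (∣∧<⇒≡0 η∣b∸a (ℕ.≤-<-trans (ℕ.m∸n≤m b a) b<η)))
  where
  η∣b∸a : η ℕ.∣ b ∸ a
  η∣b∸a = subst (η ℕ.∣_) (trans (cong ℤ.∣_∣ (ℤ.m-n≡m⊖n a b)) (ℤ.∣⊖∣-≤ a≤b)) (∣ₛ.∣⇒∣ᵤ η∣a-b)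

residue-unique : ∀ {η a b} → a < η → b < η → + a ≡ + b ⟨mod η ⟩ → a ≡ b
residue-unique {a = a} {b} a<η b<η a≡b with ℕ.≤-total a b
... | inj₁ a≤b = residue-unique-≤ a≤b b<η a≡b
... | inj₂ b≤a = sym (residue-unique-≤ b≤a a<η (≡-mod-sym a≡b))

rem-< : ∀ z η .{{_ : ℕ.NonZero η}} → rem z η < η
rem-< z (suc k) = ℤ.n%ℕd<d z (suc k)

rem-≡-mod : ∀ z η .{{_ : ℕ.NonZero η}} → z ≡ + rem z η ⟨mod η ⟩
rem-≡-mod z (suc k) = ≡-mod-by (lemma (ℤ.a≡a%ℕn+[a/ℕn]*n z (suc k))) (∣ₛ.divides (z /ℕ suc k) refl)
  where
  lemma : ∀ {z r q} → z ≡ r + q → z - r ≡ q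
  lemma {r = r} {q} refl = ring r q
    where ring : ∀ r q → (r + q) - r ≡ q
          ring = solve-∀

rem-unique : ∀ {z η y} .{{_ : ℕ.NonZero η}} → y < η → z ≡ + y ⟨mod η ⟩ → rem z η ≡ y
rem-unique {z} {η} y<η z≡y = residue-unique (rem-< z η) y<η (≡-mod-trans (≡-mod-sym (rem-≡-mod z η)) z≡y)

rem-shift : ∀ {η j s} .{{_ : ℕ.NonZero η}} → s ≤ j ℕ.+ η → j < s → rem (+ j - + s) η ≡ j ℕ.+ η ∸ s
rem-shift {η} {j} {s} s≤j+η j<s = rem-unique y<η (≡-mod-by difference (∣ₛ.∣m⇒∣-m (∣ₛ.∣-refl {+ η})))
  where
  y : ℕ
  y = j ℕ.+ η ∸ s
  y+s≡j+η : y ℕ.+ s ≡ j ℕ.+ η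
  y+s≡j+η = ℕ.m∸n+n≡m s≤j+η
  y<η : y < η
  y<η = ℕ.+-cancelʳ-< s y η (subst₂ _<_ (sym y+s≡j+η) (ℕ.+-comm s η) (ℕ.+-monoˡ-< η j<s))
  difference : (+ j - + s) - + y ≡ - + η
  difference = begin
    (+ j - + s) - + y                  ≡⟨ ring (+ j) (+ s) (+ y) (+ η) ⟩
    (+ (j ℕ.+ η) - + (y ℕ.+ s)) - + η  ≡⟨ cong (λ x → (+ (j ℕ.+ η) - + x) - + η) y+s≡j+η ⟩
    (+ (j ℕ.+ η) - + (j ℕ.+ η)) - + η  ≡⟨ cong (_- + η) (ℤ.+-inverseʳ (+ (j ℕ.+ η))) ⟩
    +0 - + η                           ≡⟨ ℤ.+-identityˡ (- + η) ⟩
    - + η                              ∎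
    where
    open ≡-Reasoning
    ring : ∀ a b c d → (a - b) - c ≡ ((a + d) - (c + b)) - d
    ring = solve-∀

≡+*⇒≡-mod : ∀ {η a r} q → a ≡ r ℕ.+ q ℕ.* η → + a ≡ + r ⟨mod η ⟩
≡+*⇒≡-mod {η} {r = r} q refl = ≡-mod-by lemma (∣ₛ.divides (+ q) (ℤ.pos-* q η))
  where
  lemma : + (r ℕ.+ q ℕ.* η) - + r ≡ + (q ℕ.* η)
  lemma = trans (cong (_- + r) (ℤ.pos-+ r (q ℕ.* η))) (ring (+ r) (+ (q ℕ.* η)))
    where ring : ∀ a b → (a + b) - a ≡ b
          ring = solve-∀

Δ^-*-idempotent : ∀ {M η f} → Δ^ η f ≈ f ⟨mod M ⟩ → ∀ q → Δ^ (q ℕ.* η) f ≈ f ⟨mod M ⟩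
Δ^-*-idempotent                 Δ^ηf≈f zero    n = ≡-mod-refl
Δ^-*-idempotent {η = η} {f} Δ^ηf≈f (suc q) =
  ≈-mod-trans (≗⇒≈-mod (Δ^-+ η (q ℕ.* η) f)) (≈-mod-trans (Δ^-cong-mod η (Δ^-*-idempotent Δ^ηf≈f q)) Δ^ηf≈f)

Δ^-idempotent-index : ∀ {M η f} .{{_ : ℕ.NonZero η}} → Δ^ η f ≈ f ⟨mod M ⟩ →
                      ∀ a z → + a ≡ z ⟨mod η ⟩ → Δ^ a f ≈ Δ^ (rem z η) f ⟨mod M ⟩
Δ^-idempotent-index {η = η} {f} Δ^ηf≈f a z a≡z = begin
  Δ^ a f                      ≡⟨ cong (λ i → Δ^ i f) a≡r+qη ⟩
  Δ^ (r ℕ.+ q ℕ.* η) f        ≈⟨ ≗⇒≈-mod (Δ^-+ r (q ℕ.* η) f) ⟩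
  Δ^ r (Δ^ (q ℕ.* η) f)       ≈⟨ Δ^-cong-mod r (Δ^-*-idempotent Δ^ηf≈f q) ⟩
  Δ^ r f                      ≡⟨ cong (λ i → Δ^ i f) r≡rem ⟩
  Δ^ (rem z η) f              ∎
  where
  open SetoidReasoning (Seq-mod _)
  r q : ℕ
  r = a ℕ.% η
  q = a ℕ./ η
  a≡r+qη : a ≡ r ℕ.+ q ℕ.* η
  a≡r+qη = ℕ.m≡m%n+[m/n]*n a η
  r≡rem : r ≡ rem z η
  r≡rem = sym (rem-unique (ℕ.m%n<n a η) (≡-mod-trans (≡-mod-sym a≡z) (≡+*⇒≡-mod q a≡r+qη)))

-- Defs' IsPeriod does not determine the sequence by unification; this record does.
record Period (m : ℕ) (f : Seq) (T : ℕ) : Set where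
  constructor period
  field
    positive : 1 ≤ T
    shift    : ∀ n → f (n ℕ.+ T) ≡ f n ⟨mod m ⟩
open Period public

IsPeriod⇒Period : ∀ {m f T} → IsPeriod m f T → Period m f T
IsPeriod⇒Period (1≤T , per) = period 1≤T (λ n → [mod]⇒⟨mod⟩ (per n))

Period⇒IsPeriod : ∀ {m f T} → Period m f T → IsPeriod m f T
Period⇒IsPeriod (period 1≤T per) = 1≤T , λ n → ⟨mod⟩⇒[mod] (per n)

period-cong : ∀ {m f g T} → f ≈ g ⟨mod m ⟩ → Period m f T → Period m g T
period-cong {T = T} f≈g (period 1≤T per) =
  period 1≤T (λ n → ≡-mod-trans (≡-mod-sym (f≈g (n ℕ.+ T))) (≡-mod-trans (per n) (f≈g n)))

period-⊕ : ∀ {m f g T} → Period m f T → Period m g T → Period m (f ⊕ g) T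
period-⊕ (period 1≤T f-per) (period _ g-per) = period 1≤T (λ n → +-cong-mod (f-per n) (g-per n))

period-⊖ : ∀ {m f T} → Period m f T → Period m (⊖ f) T
period-⊖ (period 1≤T per) = period 1≤T (neg-cong-mod ∘ per)

period-Δ^ : ∀ {m} k {f T} → Period m f T → Period m (Δ^ k f) T
period-Δ^ zero    per = per
period-Δ^ (suc k) per with period 1≤T Δ^kf-per ← period-Δ^ k per =
  period 1≤T (λ n → -‿cong-mod (Δ^kf-per (suc n)) (Δ^kf-per n))

period-*-shift : ∀ {m f T} → Period m f T → ∀ q n → f (n ℕ.+ q ℕ.* T) ≡ f n ⟨mod m ⟩
period-*-shift {f = f}     per zero    n = ≡⇒≡-mod (cong f (ℕ.+-identityʳ n))
period-*-shift {f = f} {T} per (suc q) n = ≡-mod-trans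
  (≡⇒≡-mod (cong f (trans (cong (n ℕ.+_) (ℕ.+-comm T (q ℕ.* T))) (sym (ℕ.+-assoc n (q ℕ.* T) T)))))
  (≡-mod-trans (shift per (n ℕ.+ q ℕ.* T)) (period-*-shift per q n))

period-∣ : ∀ {m f T d} → Period m f T → T ℕ.∣ d → 1 ≤ d → Period m f d
period-∣ per (divides q refl) 1≤d = period 1≤d (period-*-shift per q)

period-gcd : ∀ {m f a b} → Period m f a → Period m f b → Period m f (gcd a b)
period-gcd {f = f} {a} {b} a-per b-per = period 1≤gcd (shift-gcd (Bézout.identity (gcd-GCD a b)))
  where
  1≤gcd : 1 ≤ gcd a b
  1≤gcd = ℕ.n≢0⇒n>0 (gcd[m,n]≢0 a b (inj₁ (λ a≡0 → ℕ.<⇒≢ (positive a-per) (sym a≡0))))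
  -- d + y b = x a: from n + d, going forward y b and back x a returns to n.
  via : ∀ {a b d} → Period _ f a → Period _ f b → ∀ x y → d ℕ.+ y ℕ.* b ≡ x ℕ.* a →
        ∀ n → f (n ℕ.+ d) ≡ f n ⟨mod _ ⟩
  via {a} {b} {d} a-per b-per x y eq n = ≡-mod-trans
    (≡-mod-sym (period-*-shift b-per y (n ℕ.+ d)))
    (≡-mod-trans (≡⇒≡-mod (cong f (trans (ℕ.+-assoc n d (y ℕ.* b)) (cong (n ℕ.+_) eq))))
                 (period-*-shift a-per x n))
  shift-gcd : Bézout.Identity (gcd a b) a b → ∀ n → f (n ℕ.+ gcd a b) ≡ f n ⟨mod _ ⟩
  shift-gcd (Bézout.+- x y eq) = via a-per b-per x y eq
  shift-gcd (Bézout.-+ x y eq) = via b-per a-per y x eq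

minPeriod-∣ : ∀ {m f c T} → IsMinPeriod m f c → Period m f T → c ℕ.∣ T
minPeriod-∣ {c = c} {T} (c-per , c-min) T-per = subst (ℕ._∣ T) gcd≡c (gcd[m,n]∣m T c)
  where
  gcd≡c : gcd T c ≡ c
  gcd≡c = ℕ.≤-antisym (ℕ.∣⇒≤ {{ℕ.>-nonZero (proj₁ c-per)}} (gcd[m,n]∣n T c))
                      (c-min _ (Period⇒IsPeriod (period-gcd T-per (IsPeriod⇒Period c-per))))

-- g (n + T) − g n is constant modulo m, so a shift by m T adds m times that constant.
Δ-period⇒period : ∀ {m g T} → 1 ≤ m → Period m (Δ g) T → Period m g (m ℕ.* T)
Δ-period⇒period {m} {g} {T} 1≤m (period 1≤T Δg-per) = period (ℕ.*-mono-≤ 1≤m 1≤T) λ n → begin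
  g (n ℕ.+ m ℕ.* T)      ≈⟨ shift-* m n ⟩
  g n + + m * D 0        ≈⟨ +-cong-mod (≡-mod-refl {a = g n}) (∣⇒≡0-mod (∣ₛ.∣m⇒∣m*n (D 0) ∣ₛ.∣-refl)) ⟩
  g n + +0               ≡⟨ ℤ.+-identityʳ (g n) ⟩
  g n                    ∎
  where
  open ≡-mod-Reasoning m
  D : ℕ → ℤ
  D n = g (n ℕ.+ T) - g n
  D-const : ∀ n → D n ≡ D 0 ⟨mod m ⟩
  D-const zero    = ≡-mod-refl
  D-const (suc n) = ≡-mod-trans (≡-mod-by (ring (g (suc n ℕ.+ T)) (g (n ℕ.+ T)) (g (suc n)) (g n)) (m∣a-b (Δg-per n))) (D-const n)
    where ring : ∀ a b c d → (a - c) - (b - d) ≡ (a - b) - (c - d)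
          ring = solve-∀
  shift-* : ∀ q n → g (n ℕ.+ q ℕ.* T) ≡ g n + + q * D 0 ⟨mod m ⟩
  shift-* zero    n = ≡⇒≡-mod (trans (cong g (ℕ.+-identityʳ n)) (sym (ℤ.+-identityʳ (g n))))
  shift-* (suc q) n = begin
    g (n ℕ.+ (T ℕ.+ q ℕ.* T))                     ≡⟨ cong (λ i → g (n ℕ.+ i)) (ℕ.+-comm T (q ℕ.* T)) ⟩
    g (n ℕ.+ (q ℕ.* T ℕ.+ T))                     ≡⟨ cong g (ℕ.+-assoc n (q ℕ.* T) T) ⟨
    g (n ℕ.+ q ℕ.* T ℕ.+ T)                       ≡⟨ ring₁ (g (n ℕ.+ q ℕ.* T ℕ.+ T)) (g (n ℕ.+ q ℕ.* T)) ⟩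
    g (n ℕ.+ q ℕ.* T) + D (n ℕ.+ q ℕ.* T)          ≈⟨ +-cong-mod (shift-* q n) (D-const _) ⟩
    (g n + + q * D 0) + D 0                       ≡⟨ ring₂ (g n) (+ q) (D 0) ⟩
    g n + + suc q * D 0                           ∎
    where ring₁ : ∀ a b → a ≡ b + (a - b)
          ring₁ = solve-∀
          ring₂ : ∀ a q d → (a + q * d) + d ≡ a + (+ 1 + q) * d
          ring₂ = solve-∀

periodic-Σ^ : ∀ {m f T} → 1 ≤ m → ∀ k → Period m f T → ∃ λ T′ → Period m (Σ^ k f) T′
periodic-Σ^ 1≤m zero    per = _ , per
periodic-Σ^ 1≤m (suc k) per with _ , Σ^kf-per ← periodic-Σ^ 1≤m k per =
  _ , Δ-period⇒period 1≤m (period-cong (≈-mod-sym (≗⇒≈-mod (Δ-Σ _))) Σ^kf-per)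

-- Idempotent and nilpotent parts

1≤lcm : ∀ {b c} → 1 ≤ b → 1 ≤ c → 1 ≤ lcm b c
1≤lcm {b} {c} 1≤b 1≤c = ℕ.n≢0⇒n>0 λ lcm≡0 → ℕ.<⇒≢ (ℕ.*-mono-≤ 1≤b 1≤c)
  (sym (ℕ.0∣⇒≡0 (subst (_∣ b ℕ.* c) lcm≡0 (lcm-least (m∣m*n {b} c) (n∣m*n b {c})))))

idempotentPart : ℕ → ℕ → Seq → Seq
idempotentPart η s f = Δ^ (rem (- (+ s)) η) f

nilpotentPart : ℕ → ℕ → Seq → Seq
nilpotentPart η s f = ⊖ Σ^-poly (λ j → gen f (rem (+ j - + s) η)) s

module Decomposition {M η f} .{{_ : ℕ.NonZero η}} (Δ^ηf≈f : Δ^ η f ≈ f ⟨mod M ⟩) (s : ℕ) where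

  private
    r : ℕ
    r = rem (- (+ s)) η
    idem nil : Seq
    idem = idempotentPart η s f
    nil  = nilpotentPart η s f

    +j+r≡j-s : ∀ j → + (j ℕ.+ r) ≡ + j - + s ⟨mod η ⟩
    +j+r≡j-s j = ≡-mod-trans (≡⇒≡-mod (ℤ.pos-+ j r)) (+-cong-mod (≡-mod-refl {a = + j}) (≡-mod-sym (rem-≡-mod (- + s) η)))

  Δ^-idempotentPart : Δ^ s idem ≈ f ⟨mod M ⟩
  Δ^-idempotentPart n = begin
    Δ^ s (Δ^ r f) n                ≡⟨ Δ^-+ s r f n ⟨
    Δ^ (s ℕ.+ r) f n               ≈⟨ Δ^-idempotent-index Δ^ηf≈f (s ℕ.+ r) _ (+j+r≡j-s s) n ⟩
    Δ^ (rem (+ s - + s) η) f n     ≡⟨ cong (λ i → Δ^ i f n) rem≡0 ⟩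
    f n                            ∎
    where
    open ≡-mod-Reasoning M
    rem≡0 : rem (+ s - + s) η ≡ 0
    rem≡0 = rem-unique (ℕ.>-nonZero⁻¹ η) (≡⇒≡-mod (ℤ.+-inverseʳ (+ s)))

  gen-idempotentPart : ∀ j → gen idem j ≡ gen f (rem (+ j - + s) η) ⟨mod M ⟩
  gen-idempotentPart j = ≡-mod-trans (≡⇒≡-mod (sym (Δ^-+ j r f 0)))
                                     (Δ^-idempotent-index Δ^ηf≈f (j ℕ.+ r) _ (+j+r≡j-s j) 0)

  decomposition : Σ^ s f ≈ idem ⊕ nil ⟨mod M ⟩
  decomposition = begin
    Σ^ s f                                              ≈⟨ Σ^-cong-mod s (≈-mod-sym Δ^-idempotentPart) ⟩
    Σ^ s (Δ^ s idem)                                    ≈⟨ ≗⇒≈-mod (Σ^-Δ^ s idem) ⟩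
    idem ⊕ (⊖ sumSeq s (λ j → Σ^ j [ gen idem j ]))
      ≈⟨ (λ n → +-cong-mod (≡-mod-refl {a = idem n}) (neg-cong-mod (coefficients n))) ⟩
    idem ⊕ nil                                          ∎
    where
    open SetoidReasoning (Seq-mod M)
    coefficients : sumSeq s (λ j → Σ^ j [ gen idem j ]) ≈ sumSeq s (λ j → Σ^ j [ gen f (rem (+ j - + s) η) ]) ⟨mod M ⟩
    coefficients = sumSeq-cong-mod s (λ j → Σ^-cong-mod j (λ _ → gen-idempotentPart j))

  nilpotentPart-≈ : nil ≈ Σ^ s f ⊕ (⊖ idem) ⟨mod M ⟩
  nilpotentPart-≈ n = ≡-mod-sym (≡-mod-trans (+-cong-mod (decomposition n) ≡-mod-refl)
                                             (≡⇒≡-mod (ring (idem n) (nil n))))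
    where ring : ∀ a b → (a + b) - a ≡ b
          ring = solve-∀

  idempotentPart-idempotent : Δ^ η idem ≈ idem ⟨mod M ⟩
  idempotentPart-idempotent n = begin
    Δ^ η (Δ^ r f) n     ≡⟨ Δ^-+ η r f n ⟨
    Δ^ (η ℕ.+ r) f n    ≡⟨ cong (λ i → Δ^ i f n) (ℕ.+-comm η r) ⟩
    Δ^ (r ℕ.+ η) f n    ≡⟨ Δ^-+ r η f n ⟩
    Δ^ r (Δ^ η f) n     ≈⟨ Δ^-cong-mod r Δ^ηf≈f n ⟩
    Δ^ r f n            ∎
    where open ≡-mod-Reasoning M

  nilpotentPart-nilpotent : Δ^ s nil ≗ 𝟘
  nilpotentPart-nilpotent n = trans (Δ^-⊖ s _ n) (cong -_ (Δ^-Σ^-poly _ s n))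

  idempotentPart-period : ∀ {T} → Period M f T → Period M idem T
  idempotentPart-period = period-Δ^ r

  nilpotentPart-period : ∀ {T} → Period M (Σ^ s f) T → Period M f T → Period M nil T
  nilpotentPart-period Σ^f-per f-per =
    period-cong (≈-mod-sym nilpotentPart-≈) (period-⊕ Σ^f-per (period-⊖ (idempotentPart-period f-per)))

  Σ^-period : ∀ {T} → Period M idem T → Period M nil T → Period M (Σ^ s f) T
  Σ^-period idem-per nil-per = period-cong (≈-mod-sym decomposition) (period-⊕ idem-per nil-per)

  Σ^-minPeriod : ∀ {g b c} → (∀ {T} → 1 ≤ T → Period M (nilpotentPart η s f) T ⇔ Period M g T) →
                 IsMinPeriod M f b → IsMinPeriod M g c → IsMinPeriod M (Σ^ s f) (lcm b c)
  Σ^-minPeriod {g} {b} {c} nil⇔g b-min@(b-per , _) c-min@(c-per , _) = Period⇒IsPeriod lcm-per , lcm-least′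
    where
    f-per : Period M f b
    f-per = IsPeriod⇒Period b-per
    g-per : Period M g c
    g-per = IsPeriod⇒Period c-per
    1≤lcm[b,c] : 1 ≤ lcm b c
    1≤lcm[b,c] = 1≤lcm (positive f-per) (positive g-per)
    lcm-per : Period M (Σ^ s f) (lcm b c)
    lcm-per = Σ^-period (period-∣ (idempotentPart-period f-per) (m∣lcm[m,n] b c) 1≤lcm[b,c])
                        (Equivalence.from (nil⇔g 1≤lcm[b,c]) (period-∣ g-per (n∣lcm[m,n] b c) 1≤lcm[b,c]))
    lcm-least′ : ∀ T → IsPeriod M (Σ^ s f) T → lcm b c ≤ T
    lcm-least′ T T-per′ = ℕ.∣⇒≤ {{ℕ.>-nonZero (positive T-per)}} (lcm-least b∣T c∣T)
      where
      T-per : Period M (Σ^ s f) T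
      T-per = IsPeriod⇒Period T-per′
      f-T-per : Period M f T
      f-T-per = period-cong (≗⇒≈-mod (Δ^-Σ^-same s f)) (period-Δ^ s T-per)
      b∣T : b ∣ T
      b∣T = minPeriod-∣ b-min f-T-per
      c∣T : c ∣ T
      c∣T = minPeriod-∣ c-min (Equivalence.to (nil⇔g (positive T-per)) (nilpotentPart-period T-per f-T-per))

idempotent-decomposition : ∀ {M η f} .{{_ : ℕ.NonZero η}} → 1 ≤ M → IsPeriodic M f → Δ^ η f ≈ f [mod M ] →
  ∀ s → 1 ≤ s →
  let idem = idempotentPart η s f
      nil  = nilpotentPart η s f
  in (Σ^ s f ≈ idem ⊕ nil [mod M ])
     × IsPeriodic M idem × IsIdempotent M idem
     × IsPeriodic M nil × IsNilpotent M nil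
idempotent-decomposition {M} {η} {f} 1≤M (T , f-per′) Δ^ηf≈f s 1≤s =
  ≈⟨mod⟩⇒[mod] decomposition ,
  (T , Period⇒IsPeriod (idempotentPart-period f-per)) ,
  (η , ℕ.>-nonZero⁻¹ η , ≈⟨mod⟩⇒[mod] idempotentPart-idempotent) ,
  nilpotentPart-periodic ,
  (s , 1≤s , ≈⟨mod⟩⇒[mod] (≗⇒≈-mod nilpotentPart-nilpotent))
  where
  open Decomposition {η = η} (≈[mod]⇒⟨mod⟩ Δ^ηf≈f) s
  f-per : Period M f T
  f-per = IsPeriod⇒Period f-per′
  nilpotentPart-periodic : IsPeriodic M (nilpotentPart η s f)
  nilpotentPart-periodic with T′ , Σ^f-per ← periodic-Σ^ 1≤M s f-per =
    T′ ℕ.* T , Period⇒IsPeriod (nilpotentPart-period (period-∣ Σ^f-per (m∣m*n T) 1≤T′T) (period-∣ f-per (n∣m*n T′) 1≤T′T))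
    where
    1≤T′T : 1 ≤ T′ ℕ.* T
    1≤T′T = ℕ.*-mono-≤ (positive Σ^f-per) (positive f-per)

-- Newton's forward-difference formula

∑ : ℕ → (ℕ → ℤ) → ℤ
∑ zero    F = +0
∑ (suc n) F = ∑ n F + F n

∑-suc : ∀ n F → ∑ (suc n) F ≡ F 0 + ∑ n (λ k → F (suc k))
∑-suc zero    F = ℤ.+-comm +0 (F 0)
∑-suc (suc n) F = trans (cong (_+ F (suc n)) (∑-suc n F)) (ℤ.+-assoc (F 0) _ _)

∑-cong : ∀ n {F G} → (∀ k → k < n → F k ≡ G k) → ∑ n F ≡ ∑ n G
∑-cong zero    F≡G = refl
∑-cong (suc n) F≡G = cong₂ _+_ (∑-cong n (λ k k<n → F≡G k (ℕ.m<n⇒m<1+n k<n))) (F≡G n ℕ.≤-refl)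

∑-vanish : ∀ n {F} → (∀ k → k < n → F k ≡ +0) → ∑ n F ≡ +0
∑-vanish zero    F≡0 = refl
∑-vanish (suc n) F≡0 = cong₂ _+_ (∑-vanish n (λ k k<n → F≡0 k (ℕ.m<n⇒m<1+n k<n))) (F≡0 n ℕ.≤-refl)

∑-+ : ∀ n F G → ∑ n (λ k → F k + G k) ≡ ∑ n F + ∑ n G
∑-+ zero    F G = refl
∑-+ (suc n) F G = trans (cong (_+ (F n + G n)) (∑-+ n F G)) (ring (∑ n F) (∑ n G) (F n) (G n))
  where ring : ∀ a b c d → (a + b) + (c + d) ≡ (a + c) + (b + d)
        ring = solve-∀

∑-*ˡ : ∀ n c F → c * ∑ n F ≡ ∑ n (λ k → c * F k)
∑-*ˡ zero    c F = ℤ.*-zeroʳ c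
∑-*ˡ (suc n) c F = trans (ℤ.*-distribˡ-+ c (∑ n F) (F n)) (cong (_+ c * F n) (∑-*ˡ n c F))

∑-∣ : ∀ {x} n {F} → (∀ k → k < n → x ∣ₛ F k) → x ∣ₛ ∑ n F
∑-∣ zero    x∣F = ∣ₛ.divides +0 refl
∑-∣ (suc n) x∣F = ∣ₛ.∣m∣n⇒∣m+n (∑-∣ n (λ k k<n → x∣F k (ℕ.m<n⇒m<1+n k<n))) (x∣F n ℕ.≤-refl)

∑-∣-single : ∀ {x} n {F} K → K < n → (∀ k → k < n → k ≢ K → x ∣ₛ F k) → x ∣ₛ ∑ n F → x ∣ₛ F K
∑-∣-single (suc n) K K<1+n x∣F x∣∑ with ℕ.m≤n⇒m<n∨m≡n (ℕ.≤-pred K<1+n)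
... | inj₂ refl = ∣ₛ.∣m+n∣m⇒∣n x∣∑ (∑-∣ n (λ k k<n → x∣F k (ℕ.m<n⇒m<1+n k<n) (ℕ.<⇒≢ k<n)))
... | inj₁ K<n  = ∑-∣-single n K K<n (λ k k<n → x∣F k (ℕ.m<n⇒m<1+n k<n))
                    (∣ₛ.∣m+n∣n⇒∣m x∣∑ (x∣F n ℕ.≤-refl (ℕ.<⇒≢ K<n ∘ sym)))

-- Summing up to N ≥ T (the extra binomials vanish) keeps one length through the induction.
newton : ∀ T N h n → T ≤ N → h (n ℕ.+ T) ≡ ∑ (suc N) (λ k → + (T C k) * Δ^ k h n)
newton zero N h n _ = begin
  h (n ℕ.+ 0)                                       ≡⟨ cong h (ℕ.+-identityʳ n) ⟩
  h n                                               ≡⟨ ring (h n) ⟨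
  + 1 * h n + +0                                    ≡⟨ cong (λ x → + 1 * h n + x) (∑-vanish N λ k _ → ℤ.*-zeroˡ (Δ^ (suc k) h n)) ⟨
  + 1 * h n + ∑ N (λ k → +0 * Δ^ (suc k) h n)       ≡⟨ ∑-suc N (λ k → + (0 C k) * Δ^ k h n) ⟨
  ∑ (suc N) (λ k → + (0 C k) * Δ^ k h n)            ∎
  where
  open ≡-Reasoning
  ring : ∀ a → + 1 * a + +0 ≡ a
  ring = solve-∀
newton (suc T) (suc N) h n (s≤s T≤N) = begin
  h (n ℕ.+ suc T)                                         ≡⟨ cong h (ℕ.+-suc n T) ⟩
  h (suc (n ℕ.+ T))                                       ≡⟨ ring₁ (h (suc (n ℕ.+ T))) (h (n ℕ.+ T)) ⟩
  h (n ℕ.+ T) + Δ h (n ℕ.+ T)                             ≡⟨ cong₂ _+_ expand-h expand-Δh ⟩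
  (h₀ + ∑ (suc N) Y) + ∑ (suc N) X                         ≡⟨ ring₂ h₀ (∑ (suc N) Y) (∑ (suc N) X) ⟩
  h₀ + (∑ (suc N) X + ∑ (suc N) Y)                         ≡⟨ cong (λ x → h₀ + x) (∑-+ (suc N) X Y) ⟨
  h₀ + ∑ (suc N) (λ k → X k + Y k)                         ≡⟨ cong (λ x → h₀ + x) (∑-cong (suc N) (λ k _ → pascal k)) ⟩
  + (suc T C 0) * h n + ∑ (suc N) (λ k → + (suc T C suc k) * Δ^ (suc k) h n)
                                                          ≡⟨ ∑-suc (suc N) (λ k → + (suc T C k) * Δ^ k h n) ⟨
  ∑ (suc (suc N)) (λ k → + (suc T C k) * Δ^ k h n)        ∎
  where
  open ≡-Reasoning
  h₀ : ℤ
  h₀ = + (T C 0) * h n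
  X Y : ℕ → ℤ
  X k = + (T C k) * Δ^ (suc k) h n
  Y k = + (T C suc k) * Δ^ (suc k) h n
  expand-h : h (n ℕ.+ T) ≡ h₀ + ∑ (suc N) Y
  expand-h = trans (newton T (suc N) h n (ℕ.m≤n⇒m≤1+n T≤N)) (∑-suc (suc N) _)
  expand-Δh : Δ h (n ℕ.+ T) ≡ ∑ (suc N) X
  expand-Δh = trans (newton T N (Δ h) n T≤N)
                    (∑-cong (suc N) (λ k _ → cong (λ x → + (T C k) * x) (sym (Δ^-suc k h n))))
  pascal : ∀ k → X k + Y k ≡ + (suc T C suc k) * Δ^ (suc k) h n
  pascal k = trans (sym (ℤ.*-distribʳ-+ (Δ^ (suc k) h n) (+ (T C k)) (+ (T C suc k))))
                   (cong (λ c → + c * Δ^ (suc k) h n) (nCk+nC[k+1]≡[n+1]C[k+1] T k))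
  ring₁ : ∀ a b → a ≡ b + (a - b)
  ring₁ = solve-∀
  ring₂ : ∀ a b c → (a + b) + c ≡ a + (c + b)
  ring₂ = solve-∀

shift-difference : ∀ T h n → h (n ℕ.+ T) - h n ≡ ∑ T (λ k → + (T C suc k) * Δ^ (suc k) h n)
shift-difference T h n = begin
  h (n ℕ.+ T) - h n                        ≡⟨ cong (_- h n) (trans (newton T T h n ℕ.≤-refl) (∑-suc T _)) ⟩
  (+ 1 * h n + ∑ T Z) - h n                ≡⟨ ring (h n) (∑ T Z) ⟩
  ∑ T Z                                    ∎
  where
  open ≡-Reasoning
  Z : ℕ → ℤ
  Z k = + (T C suc k) * Δ^ (suc k) h n
  ring : ∀ a b → (+ 1 * a + b) - a ≡ b
  ring = solve-∀

Δ^-expansion : ∀ j h n → Δ^ j h n ≡ ∑ (suc n) (λ i → + (n C i) * gen h (i ℕ.+ j))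
Δ^-expansion j h n = trans (newton n n (Δ^ j h) 0 ℕ.≤-refl)
  (∑-cong (suc n) (λ i _ → cong (λ x → + (n C i) * x) (sym (Δ^-+ i j h 0))))

binomial-period : ∀ {M h T} → 1 ≤ T → (∀ k i → (+ M) ∣ₛ (+ (T C suc k) * gen h (i ℕ.+ suc k))) → Period M h T
binomial-period {M} {h} {T} 1≤T M∣ = period 1≤T (λ n → ≡-mod-by (shift-difference T h n) (∑-∣ T (λ k _ → term k n)))
  where
  term : ∀ k n → (+ M) ∣ₛ (+ (T C suc k) * Δ^ (suc k) h n)
  term k n = subst ((+ M) ∣ₛ_) (sym expand) (∑-∣ (suc n) (λ i _ → ∣ₛ.∣n⇒∣m*n (+ (n C i)) (M∣ k i)))
    where
    c : ℤ
    c = + (T C suc k)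
    expand : c * Δ^ (suc k) h n ≡ ∑ (suc n) (λ i → + (n C i) * (c * gen h (i ℕ.+ suc k)))
    expand = trans (cong (c *_) (Δ^-expansion (suc k) h n))
            (trans (∑-*ˡ (suc n) c _) (∑-cong (suc n) (λ i _ → ring c (+ (n C i)) (gen h (i ℕ.+ suc k)))))
      where ring : ∀ a b x → a * (b * x) ≡ b * (a * x)
            ring = solve-∀

period⇒∑-∣ : ∀ {M h T} → Period M h T → ∀ m → (+ M) ∣ₛ ∑ T (λ k → + (T C suc k) * gen h (suc k ℕ.+ m))
period⇒∑-∣ {M} {h} {T} per m = subst ((+ M) ∣ₛ_) expand (m∣a-b (shift (period-Δ^ m per) 0))
  where
  expand : Δ^ m h T - Δ^ m h 0 ≡ ∑ T (λ k → + (T C suc k) * gen h (suc k ℕ.+ m))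
  expand = trans (shift-difference T (Δ^ m h) 0)
                 (∑-cong T (λ k _ → cong (λ x → + (T C suc k) * x) (sym (Δ^-+ (suc k) m h 0))))

gen-vanishing⇒period : ∀ {M h} → (∀ j → (+ M) ∣ₛ gen h j) → ∀ {T} → 1 ≤ T → Period M h T
gen-vanishing⇒period {M} {h} M∣gen {T} 1≤T =
  binomial-period 1≤T (λ k i → ∣ₛ.∣n⇒∣m*n (+ (T C suc k)) (M∣gen (i ℕ.+ suc k)))

-- Binomial coefficients at prime powers

[k+1]*[n+1]C[k+1]≡[n+1]*nCk : ∀ n k → suc k ℕ.* (suc n C suc k) ≡ suc n ℕ.* (n C k)
[k+1]*[n+1]C[k+1]≡[n+1]*nCk zero zero    = refl
[k+1]*[n+1]C[k+1]≡[n+1]*nCk zero (suc k) = ℕ.*-zeroʳ (suc (suc k))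
[k+1]*[n+1]C[k+1]≡[n+1]*nCk (suc n) zero =
  trans (ℕ.*-identityˡ _) (trans (nC1≡n (suc (suc n))) (sym (ℕ.*-identityʳ (suc (suc n)))))
[k+1]*[n+1]C[k+1]≡[n+1]*nCk (suc n) (suc k) = begin
  suc (suc k) ℕ.* (suc (suc n) C suc (suc k))          ≡⟨ cong (suc (suc k) ℕ.*_) (sym (nCk+nC[k+1]≡[n+1]C[k+1] (suc n) (suc k))) ⟩
  suc (suc k) ℕ.* (A ℕ.+ B)                            ≡⟨ ring₁ k A B ⟩
  suc k ℕ.* A ℕ.+ A ℕ.+ suc (suc k) ℕ.* B              ≡⟨ cong₂ (λ a b → a ℕ.+ A ℕ.+ b) (rec k) (rec (suc k)) ⟩
  suc n ℕ.* (n C k) ℕ.+ A ℕ.+ suc n ℕ.* (n C suc k)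
    ≡⟨ cong (λ a → suc n ℕ.* (n C k) ℕ.+ a ℕ.+ suc n ℕ.* (n C suc k)) (sym (nCk+nC[k+1]≡[n+1]C[k+1] n k)) ⟩
  suc n ℕ.* (n C k) ℕ.+ (n C k ℕ.+ n C suc k) ℕ.+ suc n ℕ.* (n C suc k) ≡⟨ ring₂ n (n C k) (n C suc k) ⟩
  suc (suc n) ℕ.* (n C k ℕ.+ n C suc k)                ≡⟨ cong (suc (suc n) ℕ.*_) (nCk+nC[k+1]≡[n+1]C[k+1] n k) ⟩
  suc (suc n) ℕ.* A                                    ∎
  where
  open ≡-Reasoning
  rec : ∀ k → suc k ℕ.* (suc n C suc k) ≡ suc n ℕ.* (n C k)
  rec = [k+1]*[n+1]C[k+1]≡[n+1]*nCk n
  A B : ℕ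
  A = suc n C suc k
  B = suc n C suc (suc k)
  ring₁ : ∀ k a b → suc (suc k) ℕ.* (a ℕ.+ b) ≡ suc k ℕ.* a ℕ.+ a ℕ.+ suc (suc k) ℕ.* b
  ring₁ = ℕ-Solver.solve-∀
  ring₂ : ∀ n x y → suc n ℕ.* x ℕ.+ (x ℕ.+ y) ℕ.+ suc n ℕ.* y ≡ suc (suc n) ℕ.* (x ℕ.+ y)
  ring₂ = ℕ-Solver.solve-∀

[k+1]*NC[k+1]≡N*[N∸1]Ck : ∀ N k → 1 ≤ N → suc k ℕ.* (N C suc k) ≡ N ℕ.* ((N ∸ 1) C k)
[k+1]*NC[k+1]≡N*[N∸1]Ck (suc n) k _ = [k+1]*[n+1]C[k+1]≡[n+1]*nCk n k

m∣n∧n<m+m⇒n≡m : ∀ {m n} → 0 < n → n < m ℕ.+ m → m ∣ n → n ≡ m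
m∣n∧n<m+m⇒n≡m {m} 0<n n<2m (divides zero          refl) = ⊥-elim (ℕ.<-irrefl refl 0<n)
m∣n∧n<m+m⇒n≡m {m} 0<n n<2m (divides (suc zero)    refl) = ℕ.+-identityʳ m
m∣n∧n<m+m⇒n≡m {m} 0<n n<2m (divides (suc (suc q)) refl) =
  ⊥-elim (ℕ.<⇒≱ n<2m (ℕ.+-monoʳ-≤ m (ℕ.m≤m+n m (q ℕ.* m))))

module _ {p : ℕ} (p-prime : Prime p) where

  private instance
    p≢0 : ℕ.NonZero p
    p≢0 = prime⇒nonZero p-prime

  1<p : 1 < p
  1<p = ℕ.nonTrivial⇒n>1 p {{prime⇒nonTrivial p-prime}}

  p^-mono-∣ : ∀ {a b} → a ≤ b → p ^ a ∣ p ^ b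
  p^-mono-∣ {a} {b} a≤b = divides (p ^ (b ∸ a))
    (trans (cong (p ^_) (sym (ℕ.m+[n∸m]≡n a≤b))) (trans (ℕ.^-distribˡ-+-* p a (b ∸ a)) (ℕ.*-comm (p ^ a) _)))

  p∤1 : ¬ p ∣ 1
  p∤1 p∣1 = ℕ.<⇒≢ 1<p (sym (ℕ.∣1⇒≡1 p∣1))

  p∤m∧p^k∣m*n⇒p^k∣n : ∀ {m} n → ¬ p ∣ m → ∀ k → p ^ k ∣ m ℕ.* n → p ^ k ∣ n
  p∤m∧p^k∣m*n⇒p^k∣n n p∤m zero    _ = ℕ.1∣ n
  p∤m∧p^k∣m*n⇒p^k∣n {m} n p∤m (suc k) p^[1+k]∣mn
    with divides q refl ← p∤m∧p^k∣m*n⇒p^k∣n n p∤m k (ℕ.∣-trans (ℕ.n∣m*n p) p^[1+k]∣mn)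
    with euclidsLemma m q p-prime p∣mq
    where
    instance
      p^k≢0 : ℕ.NonZero (p ^ k)
      p^k≢0 = ℕ.m^n≢0 p k
    p∣mq : p ∣ m ℕ.* q
    p∣mq = ℕ.*-cancelˡ-∣ (p ^ k) (subst₂ _∣_ (ℕ.*-comm p (p ^ k)) (ring m q (p ^ k)) p^[1+k]∣mn)
      where ring : ∀ m q P → m ℕ.* (q ℕ.* P) ≡ P ℕ.* (m ℕ.* q)
            ring = ℕ-Solver.solve-∀
  ... | inj₁ p∣m                = ⊥-elim (p∤m p∣m)
  ... | inj₂ (divides r refl) = divides r (ring r p (p ^ k))
    where ring : ∀ r p P → r ℕ.* p ℕ.* P ≡ r ℕ.* (p ℕ.* P)
          ring = ℕ-Solver.solve-∀

  p^[w+e]∣k*b⇒p^e∣b : ∀ w e {k} b → ¬ p ^ suc w ∣ k → p ^ (w ℕ.+ e) ∣ k ℕ.* b → p ^ e ∣ b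
  p^[w+e]∣k*b⇒p^e∣b zero    e {k} b p∤k = p∤m∧p^k∣m*n⇒p^k∣n b (p∤k ∘ subst (_∣ k) (sym (ℕ.*-identityʳ p))) e
  p^[w+e]∣k*b⇒p^e∣b (suc w) e {k} b p^[2+w]∤k p^[1+w+e]∣kb with p ∣? k
  ... | no p∤k = ℕ.∣-trans (p^-mono-∣ (ℕ.m≤n+m e (suc w))) (p∤m∧p^k∣m*n⇒p^k∣n b p∤k (suc w ℕ.+ e) p^[1+w+e]∣kb)
  ... | yes (divides k′ refl) = p^[w+e]∣k*b⇒p^e∣b w e b p^[1+w]∤k′ p^[w+e]∣k′b
    where
    p^[1+w]∤k′ : ¬ p ^ suc w ∣ k′
    p^[1+w]∤k′ p^[1+w]∣k′ = p^[2+w]∤k (subst (_∣ k′ ℕ.* p) (ℕ.*-comm (p ^ suc w) p) (ℕ.*-monoˡ-∣ p p^[1+w]∣k′))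
    p^[w+e]∣k′b : p ^ (w ℕ.+ e) ∣ k′ ℕ.* b
    p^[w+e]∣k′b = ℕ.*-cancelˡ-∣ p (subst (p ℕ.* p ^ (w ℕ.+ e) ∣_) (ring k′ p b) p^[1+w+e]∣kb)
      where ring : ∀ k p b → k ℕ.* p ℕ.* b ≡ p ℕ.* (k ℕ.* b)
            ring = ℕ-Solver.solve-∀

  p^e∣[p^[w+e]]Ck : ∀ w e {k} → 1 ≤ k → ¬ p ^ suc w ∣ k → p ^ e ∣ (p ^ (w ℕ.+ e)) C k
  p^e∣[p^[w+e]]Ck w e {suc k} _ p^[1+w]∤k = p^[w+e]∣k*b⇒p^e∣b w e _ p^[1+w]∤k
    (divides ((p ^ (w ℕ.+ e) ∸ 1) C k)
             (trans ([k+1]*NC[k+1]≡N*[N∸1]Ck (p ^ (w ℕ.+ e)) k (ℕ.m^n>0 p (w ℕ.+ e))) (ℕ.*-comm (p ^ (w ℕ.+ e)) _)))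

  -- Pascal's rule carries p ∤ (N − 1) C 0 = 1 along the row.
  p∤[N∸1]Cj : ∀ {N} → (∀ k → 1 ≤ k → k < N → p ∣ N C k) → ∀ j → j < N → ¬ p ∣ (N ∸ 1) C j
  p∤[N∸1]Cj {suc n} p∣NCk zero    _   = p∤1
  p∤[N∸1]Cj {suc n} p∣NCk (suc j) j<N p∣ = p∤[N∸1]Cj p∣NCk j (ℕ.<-trans (ℕ.n<1+n j) j<N)
    (ℕ.∣m+n∣m⇒∣n (subst (p ∣_) (trans (sym (nCk+nC[k+1]≡[n+1]C[k+1] n j)) (ℕ.+-comm (n C j) _))
                                       (p∣NCk (suc j) (s≤s z≤n) j<N)) p∣)

  p∤[p^t∸1]Cj : ∀ t j → j < p ^ t → ¬ p ∣ (p ^ t ∸ 1) C j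
  p∤[p^t∸1]Cj zero    zero    _ = p∤1
  p∤[p^t∸1]Cj zero    (suc j) (s≤s ())
  p∤[p^t∸1]Cj (suc t) j j<p^t = p∤[N∸1]Cj p∣p^tCk j j<p^t
    where
    p∣p^tCk : ∀ k → 1 ≤ k → k < p ^ suc t → p ∣ p ^ suc t C k
    p∣p^tCk k 1≤k k<p^t = subst₂ (λ a b → a ∣ b C k) (ℕ.*-identityʳ p) (cong (p ^_) (ℕ.+-comm t 1))
                            (p^e∣[p^[w+e]]Ck t 1 1≤k (ℕ.>⇒∤ {{ℕ.>-nonZero 1≤k}} k<p^t))

  -- p ^ L · C(p ^ (L + d), p ^ L) = p ^ (L + d) · C(p ^ (L + d) − 1, p ^ L − 1), the latter prime to p.
  p^[v+d]∣[p^[L+d]]C[p^L]*x⇒p^v∣x : ∀ v d L x → p ^ (v ℕ.+ d) ∣ ((p ^ (L ℕ.+ d)) C (p ^ L)) ℕ.* x → p ^ v ∣ x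
  p^[v+d]∣[p^[L+d]]C[p^L]*x⇒p^v∣x v d L x p^[v+d]∣ =
    p∤m∧p^k∣m*n⇒p^k∣n x (p∤[p^t∸1]Cj (L ℕ.+ d) (P ∸ 1) P∸1<N) v (ℕ.*-cancelˡ-∣ N N*p^v∣N*C′x)
    where
    N P C′ : ℕ
    N = p ^ (L ℕ.+ d)
    P = p ^ L
    C′ = (N ∸ 1) C (P ∸ 1)
    instance
      N≢0 : ℕ.NonZero N
      N≢0 = ℕ.m^n≢0 p (L ℕ.+ d)
    P∸1<N : P ∸ 1 < N
    P∸1<N = ℕ.<-≤-trans (ℕ.∸-monoʳ-< {P} {1} {0} (s≤s z≤n) (ℕ.m^n>0 p L)) (ℕ.^-monoʳ-≤ p (ℕ.m≤m+n L d))
    P*C[N,P]≡N*C′ : P ℕ.* (N C P) ≡ N ℕ.* C′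
    P*C[N,P]≡N*C′ = trans (cong (λ k → k ℕ.* (N C k)) (sym (ℕ.suc-pred P {{ℕ.m^n≢0 p L}})))
                          ([k+1]*NC[k+1]≡N*[N∸1]Ck N (P ∸ 1) (ℕ.m^n>0 p (L ℕ.+ d)))
    exponents : P ℕ.* p ^ (v ℕ.+ d) ≡ N ℕ.* p ^ v
    exponents = trans (sym (ℕ.^-distribˡ-+-* p L (v ℕ.+ d)))
                (trans (cong (p ^_) (ring L v d)) (ℕ.^-distribˡ-+-* p (L ℕ.+ d) v))
      where ring : ∀ L v d → L ℕ.+ (v ℕ.+ d) ≡ L ℕ.+ d ℕ.+ v
            ring = ℕ-Solver.solve-∀
    N*p^v∣N*C′x : N ℕ.* p ^ v ∣ N ℕ.* (C′ ℕ.* x)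
    N*p^v∣N*C′x = subst₂ _∣_ exponents reassociate (ℕ.*-monoʳ-∣ P p^[v+d]∣)
      where
      reassociate : P ℕ.* ((N C P) ℕ.* x) ≡ N ℕ.* (C′ ℕ.* x)
      reassociate = trans (sym (ℕ.*-assoc P _ x)) (trans (cong (λ y → y ℕ.* x) P*C[N,P]≡N*C′) (ℕ.*-assoc N C′ x))

  ∣p^[1+t]⇒≡∨∣p^t : ∀ t {d} → d ∣ p ^ suc t → d ≡ p ^ suc t ⊎ d ∣ p ^ t
  ∣p^[1+t]⇒≡∨∣p^t t {d} d∣p^[1+t] with p ∣? d
  ... | no p∤d = inj₂ (coprime-divisor coprime d∣p^[1+t])
    where
    coprime : Coprime d p
    coprime (i∣d , i∣p) with prime⇒irreducible p-prime i∣p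
    ... | inj₁ i≡1    = i≡1
    ... | inj₂ refl = ⊥-elim (p∤d i∣d)
  ... | yes (divides d′ refl) = helper t (ℕ.*-cancelˡ-∣ p (subst (_∣ p ℕ.* p ^ t) (ℕ.*-comm d′ p) d∣p^[1+t]))
    where
    helper : ∀ t → d′ ∣ p ^ t → d′ ℕ.* p ≡ p ^ suc t ⊎ d′ ℕ.* p ∣ p ^ t
    helper zero    d′∣1 = inj₁ (trans (cong (λ y → y ℕ.* p) (ℕ.∣1⇒≡1 d′∣1)) (trans (ℕ.*-identityˡ p) (sym (ℕ.*-identityʳ p))))
    helper (suc t) d′∣p^[1+t] with ∣p^[1+t]⇒≡∨∣p^t t d′∣p^[1+t]
    ... | inj₁ refl    = inj₁ (ℕ.*-comm (p ^ suc t) p)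
    ... | inj₂ d′∣p^t = inj₂ (subst (d′ ℕ.* p ∣_) (ℕ.*-comm (p ^ t) p) (ℕ.*-monoˡ-∣ p d′∣p^t))

  period-of-prime-power : ∀ {M h t T} → Period M h (p ^ suc t) → ¬ Period M h (p ^ t) →
                          Period M h T → p ^ suc t ∣ T
  period-of-prime-power {t = t} {T} p^[1+t]-per ¬p^t-per T-per
    with ∣p^[1+t]⇒≡∨∣p^t t (gcd[m,n]∣n T (p ^ suc t))
  ... | inj₁ gcd≡p^[1+t] = subst (_∣ T) gcd≡p^[1+t] (gcd[m,n]∣m T _)
  ... | inj₂ gcd∣p^t     = ⊥-elim (¬p^t-per (period-∣ (period-gcd T-per p^[1+t]-per) gcd∣p^t (ℕ.m^n>0 p t)))

  p^a∣c∧p^b∣y⇒p^[a+b]∣c*y : ∀ a b {ℓ c y} → p ^ a ∣ c → (+ (p ^ b)) ∣ₛ y → a ℕ.+ b ≡ ℓ →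
                            (+ (p ^ ℓ)) ∣ₛ (+ c * y)
  p^a∣c∧p^b∣y⇒p^[a+b]∣c*y a b {c = c} {y} p^a∣c p^b∣y refl = ∣ₛ.∣ᵤ⇒∣
    (subst₂ _∣_ (sym (ℕ.^-distribˡ-+-* p a b)) (sym (ℤ.abs-* (+ c) y)) (ℕ.*-pres-∣ p^a∣c (∣ₛ.∣⇒∣ᵤ p^b∣y)))

  j<p^[1+L]⇒j+p^L<p^[2+L] : ∀ {j} L → j < p ^ suc L → j ℕ.+ p ^ L < p ^ suc (suc L)
  j<p^[1+L]⇒j+p^L<p^[2+L] {j} L j<Q = begin-strict
    j ℕ.+ p ^ L   <⟨ ℕ.+-mono-<-≤ j<Q (ℕ.^-monoʳ-≤ p (ℕ.n≤1+n L)) ⟩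
    Q ℕ.+ Q       ≡⟨ cong (λ x → Q ℕ.+ x) (sym (ℕ.+-identityʳ Q)) ⟩
    2 ℕ.* Q       ≤⟨ ℕ.*-monoˡ-≤ Q 1<p ⟩
    p ℕ.* Q       ∎
    where
    open ℕ.≤-Reasoning
    Q : ℕ
    Q = p ^ suc L

  record Leading (ℓ v j₀ s : ℕ) (h : Seq) : Set where
    field
      vanishing : ∀ j → s ≤ j → (+ (p ^ ℓ)) ∣ₛ gen h j
      divisible : ∀ j → j < s → (+ (p ^ v)) ∣ₛ gen h j
      higher    : ∀ j → j₀ < j → j < s → (+ (p ^ suc v)) ∣ₛ gen h j
      exact     : ¬ (+ (p ^ suc v)) ∣ₛ gen h j₀

  -- C(p ^ (1 + L + d), k + 1) is divisible by p ^ (1 + d) for k + 1 < p ^ (1 + L), and by p ^ d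
  -- for k + 1 < p ^ (2 + L); this compensates the valuation of the coefficients.
  leading⇒period : ∀ {ℓ v d L j₀ s h} → Leading ℓ v j₀ s h → ℓ ≡ suc v ℕ.+ d →
                   j₀ < p ^ suc L → s ≤ j₀ ℕ.+ p ^ L → Period (p ^ ℓ) h (p ^ suc (L ℕ.+ d))
  leading⇒period {ℓ} {v} {d} {L} {j₀} {s} {h} lead ℓ≡ j₀<p^[1+L] s≤j₀+p^L = binomial-period (ℕ.m^n>0 p (suc (L ℕ.+ d))) term
    where
    open Leading lead
    term : ∀ k i → (+ (p ^ ℓ)) ∣ₛ (+ (p ^ suc (L ℕ.+ d) C suc k) * gen h (i ℕ.+ suc k))
    term k i with s ℕ.≤? i ℕ.+ suc k | i ℕ.+ suc k ℕ.≤? j₀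
    ... | yes s≤j | _       = ∣ₛ.∣n⇒∣m*n (+ (p ^ suc (L ℕ.+ d) C suc k)) (vanishing _ s≤j)
    ... | no  s≰j | yes j≤j₀ = p^a∣c∧p^b∣y⇒p^[a+b]∣c*y (suc d) v
      (subst (λ t → p ^ suc d ∣ p ^ t C suc k) (ℕ.+-suc L d) (p^e∣[p^[w+e]]Ck L (suc d) (s≤s z≤n) (ℕ.>⇒∤ k<p^[1+L])))
      (divisible _ (ℕ.≰⇒> s≰j))
      (trans (cong suc (ℕ.+-comm d v)) (sym ℓ≡))
      where
      k<p^[1+L] : suc k < p ^ suc L
      k<p^[1+L] = ℕ.≤-<-trans (ℕ.≤-trans (ℕ.m≤n+m (suc k) i) j≤j₀) j₀<p^[1+L]
    ... | no  s≰j | no j≰j₀ = p^a∣c∧p^b∣y⇒p^[a+b]∣c*y d (suc v)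
      (p^e∣[p^[w+e]]Ck (suc L) d (s≤s z≤n) (ℕ.>⇒∤ k<p^[2+L]))
      (higher _ (ℕ.≰⇒> j≰j₀) (ℕ.≰⇒> s≰j))
      (trans (ℕ.+-suc d v) (trans (cong suc (ℕ.+-comm d v)) (sym ℓ≡)))
      where
      k<p^[2+L] : suc k < p ^ suc (suc L)
      k<p^[2+L] = ℕ.<-trans (ℕ.<-≤-trans (ℕ.≤-<-trans (ℕ.m≤n+m (suc k) i) (ℕ.≰⇒> s≰j)) s≤j₀+p^L)
                            (j<p^[1+L]⇒j+p^L<p^[2+L] L j₀<p^[1+L])

  -- Modulo p ^ ℓ only the term k + 1 = p ^ (1 + L) of the period equation at m = j₀ ∸ p ^ (1 + L) survives.
  period⇒p^ℓ∣C*gen : ∀ {ℓ v d L j₀ s h} → Leading ℓ v j₀ s h → ℓ ≡ suc v ℕ.+ d →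
                     p ^ suc L ≤ j₀ → s ≤ j₀ ℕ.+ p ^ suc L → Period (p ^ ℓ) h (p ^ (suc L ℕ.+ d)) →
                     (+ (p ^ ℓ)) ∣ₛ (+ (p ^ (suc L ℕ.+ d) C p ^ suc L) * gen h j₀)
  period⇒p^ℓ∣C*gen {ℓ} {v} {d} {L} {j₀} {s} {h} lead ℓ≡ P≤j₀ s≤j₀+P per =
    subst (_ ∣ₛ_) FK≡ (∑-∣-single T K K<T others (period⇒∑-∣ per m))
    where
    open Leading lead
    P T m K : ℕ
    P = p ^ suc L
    T = p ^ (suc L ℕ.+ d)
    m = j₀ ∸ P
    K = P ∸ 1
    1+K≡P : suc K ≡ P
    1+K≡P = ℕ.suc-pred P {{ℕ.m^n≢0 p (suc L)}}
    P+m≡j₀ : P ℕ.+ m ≡ j₀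
    P+m≡j₀ = ℕ.m+[n∸m]≡n P≤j₀
    K<T : K < T
    K<T = ℕ.<-≤-trans (subst (K <_) 1+K≡P (ℕ.n<1+n K)) (ℕ.^-monoʳ-≤ p (ℕ.m≤m+n (suc L) d))
    F : ℕ → ℤ
    F k = + (T C suc k) * gen h (suc k ℕ.+ m)
    FK≡ : F K ≡ + (T C P) * gen h j₀
    FK≡ = cong₂ (λ a b → + (T C a) * gen h b) 1+K≡P (trans (cong (λ y → y ℕ.+ m) 1+K≡P) P+m≡j₀)
    others : ∀ k → k < T → k ≢ K → (+ (p ^ ℓ)) ∣ₛ F k
    others k _ k≢K with s ℕ.≤? suc k ℕ.+ m
    ... | yes s≤j = ∣ₛ.∣n⇒∣m*n (+ (T C suc k)) (vanishing _ s≤j)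
    ... | no  s≰j = p^a∣c∧p^b∣y⇒p^[a+b]∣c*y (suc d) v
      (subst (λ t → p ^ suc d ∣ p ^ t C suc k) (ℕ.+-suc L d) (p^e∣[p^[w+e]]Ck L (suc d) (s≤s z≤n) P∤k+1))
      (divisible _ (ℕ.≰⇒> s≰j))
      (trans (cong suc (ℕ.+-comm d v)) (sym ℓ≡))
      where
      k+1<P+P : suc k < P ℕ.+ P
      k+1<P+P = ℕ.+-cancelʳ-< m (suc k) (P ℕ.+ P)
        (ℕ.<-≤-trans (ℕ.≰⇒> s≰j) (ℕ.≤-trans s≤j₀+P (ℕ.≤-reflexive j₀+P≡P+P+m)))
        where
        j₀+P≡P+P+m : j₀ ℕ.+ P ≡ P ℕ.+ P ℕ.+ m
        j₀+P≡P+P+m = trans (cong (λ y → y ℕ.+ P) (sym P+m≡j₀)) (ring P m)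
          where ring : ∀ P m → P ℕ.+ m ℕ.+ P ≡ P ℕ.+ P ℕ.+ m
                ring = ℕ-Solver.solve-∀
      P∤k+1 : ¬ P ∣ suc k
      P∤k+1 P∣k+1 = k≢K (ℕ.suc-injective (trans (m∣n∧n<m+m⇒n≡m (s≤s z≤n) k+1<P+P P∣k+1) (sym 1+K≡P)))

  leading⇒¬period : ∀ {ℓ v d L j₀ s h} → Leading ℓ v j₀ s h → ℓ ≡ suc v ℕ.+ d →
                    p ^ suc L ≤ j₀ → s ≤ j₀ ℕ.+ p ^ suc L → ¬ Period (p ^ ℓ) h (p ^ (suc L ℕ.+ d))
  leading⇒¬period {ℓ} {v} {d} {L} {j₀} {s} {h} lead ℓ≡ P≤j₀ s≤j₀+P per =
    Leading.exact lead (∣ₛ.∣ᵤ⇒∣ (p^[v+d]∣[p^[L+d]]C[p^L]*x⇒p^v∣x (suc v) d (suc L) ℤ.∣ gen h j₀ ∣ p^ℓ∣C*∣c∣))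
    where
    c : ℕ
    c = p ^ (suc L ℕ.+ d) C p ^ suc L
    p^ℓ∣C*∣c∣ : p ^ (suc v ℕ.+ d) ∣ c ℕ.* ℤ.∣ gen h j₀ ∣
    p^ℓ∣C*∣c∣ = subst₂ (λ e x → p ^ e ∣ x) ℓ≡ (ℤ.abs-* (+ c) (gen h j₀))
                       (∣ₛ.∣⇒∣ᵤ (period⇒p^ℓ∣C*gen {d = d} {L} lead ℓ≡ P≤j₀ s≤j₀+P per))

  leading-periods : ∀ {ℓ v d L j₀ s h} → Leading ℓ v j₀ s h → ℓ ≡ suc v ℕ.+ d →
                    p ^ suc L ≤ j₀ → j₀ < p ^ suc (suc L) → s ≤ j₀ ℕ.+ p ^ suc L →
                    ∀ {T} → 1 ≤ T → Period (p ^ ℓ) h T ⇔ p ^ suc (suc L ℕ.+ d) ∣ T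
  leading-periods {ℓ} {d = d} {L} {h = h} lead ℓ≡ P≤j₀ j₀<pP s≤j₀+P 1≤T =
    mk⇔ (period-of-prime-power {t = suc L ℕ.+ d} upper (leading⇒¬period {d = d} {L} lead ℓ≡ P≤j₀ s≤j₀+P))
        (λ ∣T → period-∣ upper ∣T 1≤T)
    where
    upper : Period (p ^ ℓ) h (p ^ suc (suc L ℕ.+ d))
    upper = leading⇒period {d = d} {suc L} lead ℓ≡ j₀<pP s≤j₀+P

  valuation : ∀ ℓ x → ∃ λ k → HasVal p ℓ x k
  valuation ℓ x = search ℓ 0 (ℕ.+-identityʳ ℓ) (ℕ.1∣ ℤ.∣ x ∣)
    where
    search : ∀ r k → r ℕ.+ k ≡ ℓ → p ^ k ∣ ℤ.∣ x ∣ → ∃ λ k → HasVal p ℓ x k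
    search zero    k refl p^k∣x = k , ℕ.≤-refl , p^k∣x , λ k<k → ⊥-elim (ℕ.<-irrefl refl k<k)
    search (suc r) k r+k≡ℓ p^k∣x with p ^ suc k ∣? ℤ.∣ x ∣
    ... | yes p^[1+k]∣x = search r (suc k) (trans (ℕ.+-suc r k) r+k≡ℓ) p^[1+k]∣x
    ... | no  p^[1+k]∤x = k , ℕ.≤-trans (ℕ.m≤n+m k (suc r)) (ℕ.≤-reflexive r+k≡ℓ) , p^k∣x , λ _ → p^[1+k]∤x

  n<p^n : ∀ n → n < p ^ n
  n<p^n zero    = s≤s z≤n
  n<p^n (suc n) = begin-strict
    suc n            <⟨ ℕ.+-mono-≤ (ℕ.m^n>0 p n) (n<p^n n) ⟩
    p ^ n ℕ.+ p ^ n    ≡⟨ cong (λ x → p ^ n ℕ.+ x) (sym (ℕ.+-identityʳ (p ^ n))) ⟩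
    2 ℕ.* p ^ n        ≤⟨ ℕ.*-monoˡ-≤ (p ^ n) 1<p ⟩
    p ^ suc n        ∎
    where open ℕ.≤-Reasoning

  ⌊log⌋ : ∀ j → 1 ≤ j → ∃ λ L → p ^ L ≤ j × j < p ^ suc L
  ⌊log⌋ j 1≤j = search j (n<p^n j)
    where
    search : ∀ N → j < p ^ N → ∃ λ L → p ^ L ≤ j × j < p ^ suc L
    search zero    j<1 = ⊥-elim (ℕ.<⇒≱ j<1 1≤j)
    search (suc N) j<p^[1+N] with j ℕ.<? p ^ N
    ... | yes j<p^N = search N j<p^N
    ... | no  j≮p^N = N , ℕ.≮⇒≥ j≮p^N , j<p^[1+N]

-- The leading component

module LeadingComponent {p ℓ f η γ} (p-prime : Prime p) .{{_ : ℕ.NonZero η}}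
                        (leading : IsLeading p ℓ f η γ) where

  private
    instance
      p≢0 : ℕ.NonZero p
      p≢0 = prime⇒nonZero p-prime
    γ<η : γ < η
    γ<η = proj₁ leading
    v : ℕ
    v = proj₁ (proj₂ leading)

  e : ℤ
  e = gen f γ

  val-e : HasVal p ℓ e v
  val-e = proj₁ (proj₂ (proj₂ leading))

  private
    minimal : ∀ i → i < η → ∃ λ w → HasVal p ℓ (gen f i) w × v ≤ w × (γ < i → v < w)
    minimal i i<η with w , val-i ← valuation p-prime ℓ (gen f i) =
      w , val-i , proj₂ (proj₂ (proj₂ leading)) i w i<η val-i

  p^v∣gen : ∀ i → i < η → (+ (p ^ v)) ∣ₛ gen f i
  p^v∣gen i i<η with w , (_ , p^w∣ , _) , v≤w , _ ← minimal i i<η =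
    ∣ₛ.∣ᵤ⇒∣ (ℕ.∣-trans (p^-mono-∣ p-prime v≤w) p^w∣)

  p^[1+v]∣gen : ∀ i → γ < i → i < η → (+ (p ^ suc v)) ∣ₛ gen f i
  p^[1+v]∣gen i γ<i i<η with w , (_ , p^w∣ , _) , _ , v<w ← minimal i i<η =
    ∣ₛ.∣ᵤ⇒∣ (ℕ.∣-trans (p^-mono-∣ p-prime (v<w γ<i)) p^w∣)

  module _ (s : ℕ) (S≤s : η ℕ.* p ℕ.+ η ≤ s) where

    j₀ : ℕ
    j₀ = s ℕ.+ γ ∸ η

    private
      nil g₀ : Seq
      nil = nilpotentPart η s f
      g₀  = Σ^ j₀ [ e ]

      η≤s : η ≤ s
      η≤s = ℕ.≤-trans (ℕ.m≤n+m η (η ℕ.* p)) S≤s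

      j₀+η≡s+γ : j₀ ℕ.+ η ≡ s ℕ.+ γ
      j₀+η≡s+γ = ℕ.m∸n+n≡m (ℕ.≤-trans η≤s (ℕ.m≤m+n s γ))

      s≤j₀+η : s ≤ j₀ ℕ.+ η
      s≤j₀+η = subst (s ≤_) (sym j₀+η≡s+γ) (ℕ.m≤m+n s γ)

      j₀<s : j₀ < s
      j₀<s = ℕ.+-cancelʳ-< η j₀ s (subst (_< s ℕ.+ η) (sym j₀+η≡s+γ) (ℕ.+-monoʳ-< s γ<η))

      ηp≤j₀ : η ℕ.* p ≤ j₀
      ηp≤j₀ = subst (_≤ j₀) (ℕ.m+n∸n≡m (η ℕ.* p) η) (ℕ.∸-monoˡ-≤ η (ℕ.≤-trans S≤s (ℕ.m≤m+n s γ)))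

      rem-j-s : ∀ j → j₀ ≤ j → j < s → rem (+ j - + s) η ≡ j ℕ.+ η ∸ s
      rem-j-s j j₀≤j = rem-shift (ℕ.≤-trans s≤j₀+η (ℕ.+-monoˡ-≤ η j₀≤j))

      rem-j₀-s : rem (+ j₀ - + s) η ≡ γ
      rem-j₀-s = trans (rem-j-s j₀ ℕ.≤-refl j₀<s) (trans (cong (_∸ s) j₀+η≡s+γ) (ℕ.m+n∸m≡n s γ))

      gen-nil-< : ∀ {j} → j < s → gen nil j ≡ - gen f (rem (+ j - + s) η)
      gen-nil-< {j} j<s = trans (gen-⊖ _ j) (cong -_ (gen-Σ^-poly-< _ j<s))

      gen-nil-≥ : ∀ {j} → s ≤ j → gen nil j ≡ +0
      gen-nil-≥ {j} s≤j = trans (gen-⊖ _ j) (cong -_ (gen-Σ^-poly-≥ _ s≤j))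

      ∣gen-nil : ∀ {x} → (∀ i → i < η → (+ x) ∣ₛ gen f i) → ∀ j → j < s → (+ x) ∣ₛ gen nil j
      ∣gen-nil x∣gen j j<s = subst (_ ∣ₛ_) (sym (gen-nil-< j<s)) (∣ₛ.∣m⇒∣-m (x∣gen _ (rem-< _ η)))

      ∣gen-nil-≥ : ∀ x j → s ≤ j → (+ x) ∣ₛ gen nil j
      ∣gen-nil-≥ x j s≤j = subst (_ ∣ₛ_) (sym (gen-nil-≥ s≤j)) (∣ₛ-zero x)

      ∣gen-g₀ : ∀ {x} → (+ x) ∣ₛ e → ∀ j → (+ x) ∣ₛ gen g₀ j
      ∣gen-g₀ {x} x∣e j with ℕ.<-cmp j j₀
      ... | tri< j<j₀ _ _ = subst (_ ∣ₛ_) (sym (gen-Σ^-below [ e ] j<j₀)) (∣ₛ-zero x)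
      ... | tri≈ _ refl _ = subst (_ ∣ₛ_) (sym (Δ^-Σ^-same j₀ [ e ] 0)) x∣e
      ... | tri> _ _ j₀<j = subst (_ ∣ₛ_) (sym (Δ^-Σ^-const-above e j₀<j 0)) (∣ₛ-zero x)

      module _ (v<ℓ : v < ℓ) where

        p^[1+v]∤e : ¬ (+ (p ^ suc v)) ∣ₛ e
        p^[1+v]∤e = proj₂ (proj₂ val-e) v<ℓ ∘ ∣ₛ.∣⇒∣ᵤ

        nil-leading : Leading p-prime ℓ v j₀ s nil
        nil-leading = record
          { vanishing = ∣gen-nil-≥ (p ^ ℓ)
          ; divisible = ∣gen-nil p^v∣gen
          ; higher    = λ j j₀<j j<s → subst (_ ∣ₛ_) (sym (gen-nil-< j<s))
                          (∣ₛ.∣m⇒∣-m (p^[1+v]∣gen _ (γ<rem j₀<j j<s) (rem-< _ η)))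
          ; exact     = λ p^[1+v]∣ → p^[1+v]∤e (subst (_ ∣ₛ_) (trans (ℤ.neg-involutive _) (cong (gen f) rem-j₀-s))
                                                     (∣ₛ.∣m⇒∣-m (subst (_ ∣ₛ_) (gen-nil-< j₀<s) p^[1+v]∣)))
          }
          where
          γ<rem : ∀ {j} → j₀ < j → j < s → γ < rem (+ j - + s) η
          γ<rem {j} j₀<j j<s = subst (γ <_) (sym (rem-j-s j (ℕ.<⇒≤ j₀<j) j<s))
            (ℕ.m+n≤o⇒m≤o∸n (suc γ) (subst (_< j ℕ.+ η) (trans j₀+η≡s+γ (ℕ.+-comm s γ)) (ℕ.+-monoˡ-< η j₀<j)))

        g₀-leading : Leading p-prime ℓ v j₀ (suc j₀) g₀
        g₀-leading = record
          { vanishing = λ j j₀<j → subst (_ ∣ₛ_) (sym (Δ^-Σ^-const-above e j₀<j 0)) (∣ₛ-zero _)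
          ; divisible = λ j _ → ∣gen-g₀ (p^v∣gen γ γ<η) j
          ; higher    = λ j j₀<j j≤j₀ → ⊥-elim (ℕ.<⇒≱ j₀<j (ℕ.≤-pred j≤j₀))
          ; exact     = p^[1+v]∤e ∘ subst (_ ∣ₛ_) (Δ^-Σ^-same j₀ [ e ] 0)
          }

      p≤j₀ : p ≤ j₀
      p≤j₀ = ℕ.≤-trans (ℕ.m≤n*m p η) ηp≤j₀

      1≤j₀ : 1 ≤ j₀
      1≤j₀ = ℕ.≤-trans (ℕ.<⇒≤ (1<p p-prime)) p≤j₀

      log-bounds : ∃ λ L → p ^ suc L ≤ j₀ × j₀ < p ^ suc (suc L) × η ≤ p ^ suc L
      log-bounds with ⌊log⌋ p-prime j₀ 1≤j₀
      ... | zero  , _ , j₀<p^1 = ⊥-elim (ℕ.<⇒≱ j₀<p^1 (ℕ.≤-trans (ℕ.≤-reflexive (ℕ.*-identityʳ p)) p≤j₀))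
      ... | suc L , P≤j₀ , j₀<pP =
        L , P≤j₀ , j₀<pP ,
        ℕ.<⇒≤ (ℕ.*-cancelʳ-< p η (p ^ suc L) (ℕ.≤-<-trans ηp≤j₀ (subst (j₀ <_) (ℕ.*-comm p _) j₀<pP)))

    nilpotentPart⇔Σ^[e] : ∀ {T} → 1 ≤ T → Period (p ^ ℓ) (nilpotentPart η s f) T ⇔ Period (p ^ ℓ) (Σ^ j₀ [ e ]) T
    -- If v = ℓ both sequences vanish modulo p ^ ℓ; otherwise both have a leading coefficient at j₀.
    nilpotentPart⇔Σ^[e] 1≤T with ℕ.m≤n⇒m<n∨m≡n (proj₁ val-e)
    ... | inj₂ refl = mk⇔ (λ _ → gen-vanishing⇒period (∣gen-g₀ (p^v∣gen γ γ<η)) 1≤T)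
                          (λ _ → gen-vanishing⇒period nil-vanishing 1≤T)
      where
      nil-vanishing : ∀ j → (+ (p ^ ℓ)) ∣ₛ gen nil j
      nil-vanishing j with s ℕ.≤? j
      ... | yes s≤j = ∣gen-nil-≥ _ j s≤j
      ... | no  s≰j = ∣gen-nil p^v∣gen j (ℕ.≰⇒> s≰j)
    ... | inj₁ v<ℓ with L , P≤j₀ , j₀<pP , η≤P ← log-bounds =
      ⇔.trans (leading-periods p-prime {L = L} (nil-leading v<ℓ) ℓ≡ P≤j₀ j₀<pP s≤j₀+P 1≤T)
              (⇔.sym (leading-periods p-prime {L = L} (g₀-leading v<ℓ) ℓ≡ P≤j₀ j₀<pP 1+j₀≤j₀+P 1≤T))
      where
      ℓ≡ : ℓ ≡ suc v ℕ.+ (ℓ ∸ suc v)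
      ℓ≡ = sym (ℕ.m+[n∸m]≡n v<ℓ)
      s≤j₀+P : s ≤ j₀ ℕ.+ p ^ suc L
      s≤j₀+P = ℕ.≤-trans s≤j₀+η (ℕ.+-monoʳ-≤ j₀ η≤P)
      1+j₀≤j₀+P : suc j₀ ≤ j₀ ℕ.+ p ^ suc L
      1+j₀≤j₀+P = subst (_≤ j₀ ℕ.+ p ^ suc L) (ℕ.+-comm j₀ 1) (ℕ.+-monoʳ-≤ j₀ (ℕ.m^n>0 p (suc L)))

eventual-minPeriod : ∀ {p ℓ f η γ} → Prime p → .{{_ : ℕ.NonZero η}} → Δ^ η f ≈ f [mod p ^ ℓ ] →
  IsLeading p ℓ f η γ →
  ∃ λ S → ∀ s → S ≤ s → ∀ b c → IsMinPeriod (p ^ ℓ) f b → IsMinPeriod (p ^ ℓ) (Σ^ (s ℕ.+ γ ∸ η) [ gen f γ ]) c →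
          IsMinPeriod (p ^ ℓ) (Σ^ s f) (lcm b c)
eventual-minPeriod {p} {η = η} p-prime Δ^ηf≈f leading = η ℕ.* p ℕ.+ η , λ s S≤s b c b-min c-min →
  Decomposition.Σ^-minPeriod {η = η} (≈[mod]⇒⟨mod⟩ Δ^ηf≈f) s (nilpotentPart⇔Σ^[e] s S≤s) b-min c-min
  where open LeadingComponent p-prime leading

theorem3p10 : (p ℓ : ℕ) → Prime p → 1 ≤ ℓ →
    (f : Seq) → IsPeriodic (p ^ ℓ) f → IsIdempotent (p ^ ℓ) f →
    (η : ℕ) → IsIdempotencyIndex (p ^ ℓ) f η →
    ((s : ℕ) → 1 ≤ s →
      let idem = Δ^ (rem (- (+ s)) η) f
          nil  = ⊖ sumSeq s (λ j → Σ^ j [ gen f (rem (+ j - + s) η) ])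
      in (Σ^ s f ≈ idem ⊕ nil [mod p ^ ℓ ])
         × IsPeriodic (p ^ ℓ) idem × IsIdempotent (p ^ ℓ) idem
         × IsPeriodic (p ^ ℓ) nil × IsNilpotent (p ^ ℓ) nil)
    × ((γ : ℕ) → IsLeading p ℓ f η γ →
       ∃ λ S → (s : ℕ) → S ≤ s → (b c : ℕ) →
         IsMinPeriod (p ^ ℓ) f b →
         IsMinPeriod (p ^ ℓ) (Σ^ (s ℕ.+ γ ∸ η) [ gen f γ ]) c →
         IsMinPeriod (p ^ ℓ) (Σ^ s f) (lcm b c))
theorem3p10 p ℓ p-prime _ f f-periodic _ η (1≤η , Δ^ηf≈f , _) =
  idempotent-decomposition (ℕ.m^n>0 p ℓ) f-periodic Δ^ηf≈f ,
  λ γ → eventual-minPeriod p-prime Δ^ηf≈f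
  where
  instance
    η≢0 : ℕ.NonZero η
    η≢0 = ℕ.>-nonZero 1≤η
    p≢0 : ℕ.NonZero p
    p≢0 = prime⇒nonZero p-prime
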